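{- The map $\mathrm{Prune}:\mathcal{T}\to\mathrm{PT}$, sending a binary tree $T$ to the unique pruned binary tree $T_p$ with $[T_p]=[T]$, is computable (as a map between $\mathbb{T}^\omega$-represented spaces), and its multivalued inverse $\mathrm{PT}\rightrightarrows\mathcal{T}$, $P\mapsto\{T\in\mathcal{T}\mid\mathrm{Prune}(T)=P\}$, is computable.
   Context: A binary tree is a set $T\subseteq\{0,1\}^*$ closed under prefixes $\sqsubseteq$; $[T]$ is the set of $p\in\{0,1\}^\omega$ with all finite prefixes in $T$. $T$ is pruned if every $w\in T$ has a proper extension in $T$. Fix a standard computable bijection $\nu:\mathbb{N}\to\{0,1\}^*$. The represented space $\mathcal{T}$ of binary trees represents $T$ by its characteristic sequence $n\mapsto\chi_T(\nu(n))\in\{0,1\}^\omega$. Plotkin's $\mathbb{T}=\{0,1,\bot\}$ is represented by $\delta_\mathbb{T}(0^\omega)=\bot$, $\delta_\mathbb{T}(p)=0$ if $\min\{n\mid p(n)=1\}$ is even and $1$ if odd; $\mathbb{T}^\omega$ carries the induced product representation $\delta_{\mathbb{T}^\omega}$. A $\mathbb{T}^\omega$-represented space is a set $Y$ with a partial surjection $\psi_Y:\subseteq\mathbb{T}^\omega\to Y$; ordinary represented spaces are special cases since $\{0,1\}^\omega\subseteq\mathbb{T}^\omega$. A multivalued $F:\subseteq\mathbb{T}^\omega\rightrightarrows\mathbb{T}^\omega$ is computable if some computable $G:\subseteq\{0,1\}^\omega\to\{0,1\}^\omega$ satisfies $\delta_{\mathbb{T}^\omega}(G(r))\in F(\delta_{\mathbb{T}^\omega}(r))$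 whenever $\delta_{\mathbb{T}^\omega}(r)\in\operatorname{dom}(F)$. $F$ is a $\mathbb{T}^\omega$-realizer of $f:\subseteq Y\rightrightarrows Z$ if $\emptyset\neq\psi_Z(F(p))\subseteq f(\psi_Y(p))$ for all $p\in\operatorname{dom}(f\circ\psi_Y)$; $f$ is computable if it has a computable $\mathbb{T}^\omega$-realizer. $\mathrm{PT}$ is the set of pruned binary trees with the $\mathbb{T}^\omega$-representation $\delta_{\mathrm{PT}}:\mathbb{T}^\omega\to\mathrm{PT}$: $\delta_{\mathrm{PT}}(p)=\emptyset$ if $p(0)\neq\bot$; if $p(0)=\bot$, then $\delta_{\mathrm{PT}}(p)$ is the tree $T$ with $\varepsilon\in T$ and such that for every $w\in T$ with $n=\nu^{ -1}(w)$: $w0\in T$ iff $p(n+1)\neq1$, and $w1\in T$ iff $p(n+1)\neq0$. -}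

module Defs where

open import Data.Nat using (ℕ; zero; suc; _+_; _<_; _≟_)
open import Data.Bool using (Bool; true; false; if_then_else_)
open import Data.List using (List; []; _∷_; _++_; reverse; take) renaming ([_] to ⟦_⟧)
open import Data.Maybe using (Maybe; just; nothing)
open import Data.Product using (Σ; ∃; _×_; _,_; proj₁)
open import Relation.Binary.PropositionalEquality using (_≡_; _≢_)
open import Relation.Nullary using (¬_; yes; no)

Cantor : Set
Cantor = ℕ → Bool

Word : Set
Word = List Bool

prefix : Cantor → ℕ → Word
prefix p zero    = []
prefix p (suc n) = prefix p n ++ ⟦ p n ⟧

-- A fixed standard computable bijection ν : ℕ → {0,1}* (length-lexicographic
-- enumeration ε,0,1,00,01,10,11,000,…), obtained by iterating a binary
-- successor on little-endian words and reversing.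
incLE : Word → Word
incLE []          = false ∷ []
incLE (false ∷ w) = true ∷ w
incLE (true ∷ w)  = false ∷ incLE w

νLE : ℕ → Word
νLE zero    = []
νLE (suc n) = incLE (νLE n)

ν : ℕ → Word
ν n = reverse (νLE n)

WordSet : Set
WordSet = Word → Bool

PrefixClosed : WordSet → Set
PrefixClosed T = ∀ (w v : Word) → T (w ++ v) ≡ true → T w ≡ true

record Tree : Set where
  constructor mkTree
  field
    set    : WordSet
    closed : PrefixClosed set
open Tree public

_∈T_ : Word → Tree → Set
w ∈T T = set T w ≡ true

_∈[_] : Cantor → Tree → Set
p ∈[ T ] = ∀ n → prefix p n ∈T T

Pruned : Tree → Set
Pruned T = ∀ w → w ∈T T → ∃ λ v → (v ≢ []) × ((w ++ v) ∈T T)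

record PTree : Set where
  constructor mkPT
  field
    tree   : Tree
    pruned : Pruned tree
open PTree public

IsPrune : Tree → PTree → Set
IsPrune T P = ∀ p → (p ∈[ tree P ] → p ∈[ T ]) × (p ∈[ T ] → p ∈[ tree P ])

data Tri : Set where
  zeroT oneT botT : Tri

TSeq : Set
TSeq = ℕ → Tri

data Even : ℕ → Set where
  ev0  : Even zero
  evSS : ∀ {n} → Even n → Even (suc (suc n))

data δT (p : Cantor) : Tri → Set where
  bot  : (∀ n → p n ≡ false) → δT p botT
  fst0 : ∀ n → p n ≡ true → (∀ m → m < n → p m ≡ false) → Even n → δT p zeroT
  fst1 : ∀ n → p n ≡ true → (∀ m → m < n → p m ≡ false) → ¬ Even n → δT p oneT

triangle : ℕ → ℕ
triangle zero    = zero
triangle (suc k) = suc k + triangle k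

pair : ℕ → ℕ → ℕ
pair i n = triangle (i + n) + n

δTω : Cantor → TSeq → Set
δTω r x = ∀ i → δT (λ n → r (pair i n)) (x i)

data Instr : Set where
  inc : (reg next : ℕ) → Instr
  dec : (reg next ifZero : ℕ) → Instr
  orc : (reg src next : ℕ) → Instr

Program : Set
Program = List Instr

fetch : Program → ℕ → Maybe Instr
fetch []       _       = nothing
fetch (i ∷ is) zero    = just i
fetch (i ∷ is) (suc n) = fetch is n

Regs : Set
Regs = ℕ → ℕ

set! : Regs → ℕ → ℕ → Regs
set! R a v b with a ≟ b
... | yes _ = v
... | no  _ = R b

pred : ℕ → ℕ
pred zero    = zero
pred (suc n) = n

Config : Set
Config = ℕ × Regs

step : Program → Cantor → Config → Config
step e r (pc , R) with fetch e pc
... | nothing            = pc , R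
... | just (inc a j)     = j , set! R a (suc (R a))
... | just (dec a j k)   with R a
...   | zero  = k , R
...   | suc m = j , set! R a m
step e r (pc , R) | just (orc a s j) = j , set! R a (if r (R s) then 1 else 0)

run : Program → Cantor → ℕ → Config → Config
run e r zero    c = c
run e r (suc k) c = run e r k (step e r c)

initial : ℕ → Config
initial n = zero , λ { zero → n ; (suc _) → zero }

bit : Bool → ℕ
bit true  = 1
bit false = 0

Halts : Program → Cantor → ℕ → Bool → Set
Halts e r n b = ∃ λ k →
  let c = run e r k (initial n) in
  (fetch e (proj₁ c) ≡ nothing) × (Data.Product.proj₂ c zero ≡ bit b)

Computes : Program → Cantor → Cantor → Set
Computes e r q = ∀ n → Halts e r n (q n)

MV : Set → Set → Set₁
MV A B = A → B → Set

dom : {A B : Set} → MV A B → A → Set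
dom F a = ∃ λ b → F a b

ComputableMV : MV TSeq TSeq → Set
ComputableMV F = ∃ λ (e : Program) →
  ∀ (r : Cantor) (x : TSeq) → δTω r x → dom F x →
    ∃ λ (q : Cantor) → Computes e r q × (∀ y → δTω q y → F x y)

-- 𝕋^ω-represented space: a carrier with a partial surjection ψ (as a
-- functional relation)
record TRep : Set₁ where
  field
    Carrier : Set
    ψ       : TSeq → Carrier → Set
open TRep public

Realizes : (Y Z : TRep) → MV TSeq TSeq → MV (Carrier Y) (Carrier Z) → Set
Realizes Y Z F f = ∀ (p : TSeq) (y : Carrier Y) → ψ Y p y → dom f y →
  (∃ λ q → F p q × dom (ψ Z) q) ×
  (∀ q → F p q → dom (ψ Z) q × (∀ z → ψ Z q z → f y z))

ComputableMap : (Y Z : TRep) → MV (Carrier Y) (Carrier Z) → Set₁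
ComputableMap Y Z f = Σ (MV TSeq TSeq) λ F → ComputableMV F × Realizes Y Z F f

toTri : Bool → Tri
toTri true  = oneT
toTri false = zeroT

𝒯 : TRep
𝒯 = record
  { Carrier = Tree
  ; ψ = λ x T → ∀ n → x n ≡ toTri (set T (ν n)) }

δPT : TSeq → PTree → Set
δPT x P =
  (x zero ≢ botT → ∀ w → set (tree P) w ≡ false) ×
  (x zero ≡ botT →
     ([] ∈T tree P) ×
     (∀ w n → w ∈T tree P → ν n ≡ w →
        ((w ++ ⟦ false ⟧) ∈T tree P → x (suc n) ≢ oneT) ×
        (x (suc n) ≢ oneT → (w ++ ⟦ false ⟧) ∈T tree P) ×
        ((w ++ ⟦ true ⟧) ∈T tree P → x (suc n) ≢ zeroT) ×
        (x (suc n) ≢ zeroT → (w ++ ⟦ true ⟧) ∈T tree P)))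

PT : TRep
PT = record { Carrier = PTree ; ψ = δPT }

Prune : MV Tree PTree
Prune T P = IsPrune T P

PruneInv : MV PTree Tree
PruneInv P T = IsPrune T P

module Submission where

-- Both realizers are register-machine programs, obtained by compiling oracle primitive recursive
-- definitions. From a name of a pruned tree P we output the tree of nodes none of whose ancestors has
-- been excluded by the name within as many steps as the node's own index; an excluded node only
-- disappears at deeper levels, so this tree has dead ends, but its infinite paths are those of P.
-- From a tree T we name the tree in which the parent of a node excludes it as soon as all descendants
-- of the node at some depth are seen to lie outside T. The first 1 of a 𝕋-code excludes only one
-- child, so the named tree is pruned. No path of T passes a node declared dead in this way, and
-- neither does a path of the named tree: a node on it whose parent excludes the other child instead
-- has two dead children and is itself dead, and at the root this would empty the tree.

open import Defs
open import Data.Nat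
open import Data.Nat.Properties
open import Data.Nat.Tactic.RingSolver using (solve-∀)
open import Data.Fin using (Fin; zero; suc)
open import Data.Vec.Functional using (Vector) renaming (_∷_ to _∷ᵛ_)
open import Data.Bool using (Bool; true; false; if_then_else_; _∧_; _∨_; not) renaming (_≟_ to _≟ᵇ_)
open import Data.Bool.Properties using (T-≡; ∧-conicalˡ; ∧-conicalʳ; ∧-assoc; ¬-not)
open import Data.List using (List; []; _∷_; _++_; length; reverse)
open import Data.List.Properties using (length-++; reverse-++; reverse-involutive; ++-identityʳ; ++-assoc)
open import Data.Maybe using (just; nothing)
open import Data.Product
open import Data.Sum using (_⊎_; inj₁; inj₂; [_,_]′)
open import Data.Empty using (⊥; ⊥-elim)
open import Function using (_∘_)
open import Function.Bundles using (Equivalence)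
open import Relation.Binary.PropositionalEquality
open import Relation.Binary.Definitions using (tri<; tri≈; tri>)
open import Relation.Nullary using (¬_; Dec; yes; no)
open import Relation.Nullary.Decidable using (toSum)

-- Register machines

run-+ : ∀ e r k₁ k₂ c → run e r (k₁ + k₂) c ≡ run e r k₂ (run e r k₁ c)
run-+ e r zero    k₂ c = refl
run-+ e r (suc k₁) k₂ c = run-+ e r k₁ k₂ (step e r c)

record Reach (e : Program) (r : Cantor) (pc : ℕ) (R : Regs) (pc′ : ℕ) (R′ : Regs) : Set where
  constructor _,_
  field
    steps : ℕ
    runs  : run e r steps (pc , R) ≡ (pc′ , R′)

reach-trans : ∀ {e r a b c R R′ R″} → Reach e r a R b R′ → Reach e r b R′ c R″ → Reach e r a R c R″
reach-trans {e} {r} {a} {R = R} (k₁ , p) (k₂ , q) =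
  k₁ + k₂ , trans (run-+ e r k₁ k₂ (a , R)) (trans (cong (run e r k₂) p) q)

reach-cast : ∀ {e r a b b′ R R′} → b ≡ b′ → Reach e r a R b R′ → Reach e r a R b′ R′
reach-cast refl p = p

module _ {e : Program} {r : Cantor} {pc : ℕ} {R : Regs} where

  step-inc : ∀ {a j} → fetch e pc ≡ just (inc a j) → Reach e r pc R j (set! R a (suc (R a)))
  step-inc {a} {j} eq = 1 , executes
    where
    executes : step e r (pc , R) ≡ (j , set! R a (suc (R a)))
    executes rewrite eq = refl

  step-dec-zero : ∀ {a j k} → fetch e pc ≡ just (dec a j k) → R a ≡ zero → Reach e r pc R k R
  step-dec-zero {a} {j} {k} eq Ra≡0 = 1 , executes
    where
    executes : step e r (pc , R) ≡ (k , R)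
    executes rewrite eq | Ra≡0 = refl

  step-dec-suc : ∀ {a j k m} → fetch e pc ≡ just (dec a j k) → R a ≡ suc m → Reach e r pc R j (set! R a m)
  step-dec-suc {a} {j} {k} {m} eq Ra≡1+m = 1 , executes
    where
    executes : step e r (pc , R) ≡ (j , set! R a m)
    executes rewrite eq | Ra≡1+m = refl

  step-orc : ∀ {a s j} → fetch e pc ≡ just (orc a s j) → Reach e r pc R j (set! R a (if r (R s) then 1 else 0))
  step-orc {a} {s} {j} eq = 1 , executes
    where
    executes : step e r (pc , R) ≡ (j , set! R a (if r (R s) then 1 else 0))
    executes rewrite eq = refl

set!-same : ∀ R a v → set! R a v a ≡ v
set!-same R a v with a ≟ a
... | yes _ = refl
... | no a≢a = ⊥-elim (a≢a refl)

set!-other : ∀ R a v x → x ≢ a → set! R a v x ≡ R x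
set!-other R a v x x≢a with a ≟ x
... | yes refl = ⊥-elim (x≢a refl)
... | no _ = refl

record LoadedAt (e : Program) (b : ℕ) (c : List Instr) : Set where
  constructor loaded
  field at : ∀ i → i < length c → fetch e (b + i) ≡ fetch c i
open LoadedAt

fetch-++ˡ : ∀ (c₁ c₂ : List Instr) i → i < length c₁ → fetch (c₁ ++ c₂) i ≡ fetch c₁ i
fetch-++ˡ (x ∷ c₁) c₂ zero    _         = refl
fetch-++ˡ (x ∷ c₁) c₂ (suc i) (s≤s i<) = fetch-++ˡ c₁ c₂ i i<

fetch-++ʳ : ∀ (c₁ c₂ : List Instr) i → fetch (c₁ ++ c₂) (length c₁ + i) ≡ fetch c₂ i
fetch-++ʳ []       c₂ i = refl
fetch-++ʳ (x ∷ c₁) c₂ i = fetch-++ʳ c₁ c₂ i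

fetch-length : ∀ (c : List Instr) → fetch c (length c) ≡ nothing
fetch-length []      = refl
fetch-length (x ∷ c) = fetch-length c

loaded-++ˡ : ∀ {e b} c₁ c₂ → LoadedAt e b (c₁ ++ c₂) → LoadedAt e b c₁
loaded-++ˡ c₁ c₂ L = loaded λ i i< →
  trans (at L i (<-≤-trans i< (≤-trans (m≤m+n _ _) (≤-reflexive (sym (length-++ c₁)))))) (fetch-++ˡ c₁ c₂ i i<)

loaded-++ʳ : ∀ {e b} c₁ c₂ → LoadedAt e b (c₁ ++ c₂) → LoadedAt e (b + length c₁) c₂
loaded-++ʳ {e} {b} c₁ c₂ L = loaded λ i i< →
  trans (cong (fetch e) (+-assoc b (length c₁) i))
    (trans (at L (length c₁ + i) (subst (length c₁ + i <_) (sym (length-++ c₁)) (+-monoʳ-< (length c₁) i<)))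
      (fetch-++ʳ c₁ c₂ i))

loaded-head : ∀ {e b x c} → LoadedAt e b (x ∷ c) → fetch e b ≡ just x
loaded-head {e} {b} L = trans (cong (fetch e) (sym (+-identityʳ b))) (at L 0 (s≤s z≤n))

loaded-tail : ∀ {e b x c} → LoadedAt e b (x ∷ c) → LoadedAt e (b + 1) c
loaded-tail {e} {b} L = loaded λ i i< →
  trans (cong (fetch e) (+-assoc b 1 i)) (at L (suc i) (s≤s i<))

-- relocatable code: jump targets are computed from the address the code is loaded at
Code : Set
Code = ℕ → List Instr

end : Code → ℕ → ℕ
end c b = b + length (c b)

_⨾_ : Code → Code → Code
(c₁ ⨾ c₂) b = c₁ b ++ c₂ (end c₁ b)
infixr 4 _⨾_

module _ {e : Program} {b : ℕ} (c₁ c₂ : Code) where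

  loaded-⨾ˡ : LoadedAt e b ((c₁ ⨾ c₂) b) → LoadedAt e b (c₁ b)
  loaded-⨾ˡ = loaded-++ˡ (c₁ b) _

  loaded-⨾ʳ : LoadedAt e b ((c₁ ⨾ c₂) b) → LoadedAt e (end c₁ b) (c₂ (end c₁ b))
  loaded-⨾ʳ = loaded-++ʳ (c₁ b) _

  end-⨾ : end c₂ (end c₁ b) ≡ end (c₁ ⨾ c₂) b
  end-⨾ = trans (+-assoc b (length (c₁ b)) _) (cong (b +_) (sym (length-++ (c₁ b))))

  reach-⨾ : ∀ {r R R₁ R₂} → Reach e r b R (end c₁ b) R₁ → Reach e r (end c₁ b) R₁ (end c₂ (end c₁ b)) R₂ →
            Reach e r b R (end (c₁ ⨾ c₂) b) R₂
  reach-⨾ p q = reach-cast end-⨾ (reach-trans p q)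

clear : ℕ → Code
clear a b = dec a b (b + 1) ∷ []

clear-correct : ∀ {e r} a b → LoadedAt e b (clear a b) → ∀ R → ∃ λ R′ →
  Reach e r b R (b + 1) R′ × R′ a ≡ 0 × (∀ x → x ≢ a → R′ x ≡ R x)
clear-correct {e} {r} a b L R = go (R a) R refl
  where
  go : ∀ n R → R a ≡ n → ∃ λ R′ → Reach e r b R (b + 1) R′ × R′ a ≡ 0 × (∀ x → x ≢ a → R′ x ≡ R x)
  go zero R Ra≡0 = R , step-dec-zero (loaded-head L) Ra≡0 , Ra≡0 , λ _ _ → refl
  go (suc m) R Ra≡1+m with go m (set! R a m) (set!-same R a m)
  ... | R′ , p , R′a , frame =
    R′ , reach-trans (step-dec-suc (loaded-head L) Ra≡1+m) p , R′a ,
    λ x x≢a → trans (frame x x≢a) (set!-other R a m x x≢a)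

move : ℕ → ℕ → Code
move a d b = dec a (b + 1) (b + 2) ∷ inc d b ∷ []

move-correct : ∀ {e r} a d b → a ≢ d → LoadedAt e b (move a d b) → ∀ R → ∃ λ R′ →
  Reach e r b R (b + 2) R′ × R′ a ≡ 0 × R′ d ≡ R d + R a × (∀ x → x ≢ a → x ≢ d → R′ x ≡ R x)
move-correct {e} {r} a d b a≢d L R = go (R a) R refl
  where
  go : ∀ n R → R a ≡ n → ∃ λ R′ →
    Reach e r b R (b + 2) R′ × R′ a ≡ 0 × R′ d ≡ R d + n × (∀ x → x ≢ a → x ≢ d → R′ x ≡ R x)
  go zero R Ra≡0 = R , step-dec-zero (loaded-head L) Ra≡0 , Ra≡0 , sym (+-identityʳ _) , λ _ _ _ → refl
  go (suc m) R Ra≡1+m with go m R₂ (trans (set!-other R₁ d _ a a≢d) (set!-same R a m))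
    where
    R₁ = set! R a m
    R₂ = set! R₁ d (suc (R₁ d))
  ... | R′ , p , R′a , R′d , frame =
    R′ , reach-trans (step-dec-suc (loaded-head L) Ra≡1+m) (reach-trans (step-inc (loaded-head (loaded-tail L))) p) ,
    R′a ,
    trans R′d (trans (cong (_+ m) (trans (set!-same _ d _) (cong suc (set!-other R a m d (≢-sym a≢d)))))
                     (sym (+-suc _ m))) ,
    λ x x≢a x≢d → trans (frame x x≢a x≢d) (trans (set!-other _ d _ x x≢d) (set!-other R a m x x≢a))

move₂ : ℕ → ℕ → ℕ → Code
move₂ a d t b = dec a (b + 1) (b + 3) ∷ inc d (b + 1 + 1) ∷ inc t b ∷ []

move₂-correct : ∀ {e r} a d t b → a ≢ d → a ≢ t → d ≢ t → LoadedAt e b (move₂ a d t b) → ∀ R → ∃ λ R′ →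
  Reach e r b R (b + 3) R′ × R′ a ≡ 0 × R′ d ≡ R d + R a × R′ t ≡ R t + R a ×
  (∀ x → x ≢ a → x ≢ d → x ≢ t → R′ x ≡ R x)
move₂-correct {e} {r} a d t b a≢d a≢t d≢t L R = go (R a) R refl
  where
  go : ∀ n R → R a ≡ n → ∃ λ R′ →
    Reach e r b R (b + 3) R′ × R′ a ≡ 0 × R′ d ≡ R d + n × R′ t ≡ R t + n ×
    (∀ x → x ≢ a → x ≢ d → x ≢ t → R′ x ≡ R x)
  go zero R Ra≡0 = R , step-dec-zero (loaded-head L) Ra≡0 , Ra≡0 , sym (+-identityʳ _) , sym (+-identityʳ _) ,
    λ _ _ _ _ → refl
  go (suc m) R Ra≡1+m with go m R₃ R₃a
    where
    R₁ = set! R a m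
    R₂ = set! R₁ d (suc (R₁ d))
    R₃ = set! R₂ t (suc (R₂ t))
    R₃a : R₃ a ≡ m
    R₃a = trans (set!-other R₂ t _ a a≢t) (trans (set!-other R₁ d _ a a≢d) (set!-same R a m))
  ... | R′ , p , R′a , R′d , R′t , frame =
    R′ ,
    reach-trans (step-dec-suc (loaded-head L) Ra≡1+m)
      (reach-trans (step-inc (loaded-head (loaded-tail L)))
        (reach-trans (step-inc (loaded-head (loaded-tail (loaded-tail L)))) p)) ,
    R′a ,
    trans R′d (trans (cong (_+ m) (trans (set!-other _ t _ d d≢t)
                                   (trans (set!-same _ d _) (cong suc (set!-other R a m d (≢-sym a≢d))))))
                     (sym (+-suc _ m))) ,
    trans R′t (trans (cong (_+ m) (trans (set!-same _ t _)
                                   (cong suc (trans (set!-other _ d _ t (≢-sym d≢t)) (set!-other R a m t (≢-sym a≢t))))))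
                     (sym (+-suc _ m))) ,
    λ x x≢a x≢d x≢t → trans (frame x x≢a x≢d x≢t)
      (trans (set!-other _ t _ x x≢t) (trans (set!-other _ d _ x x≢d) (set!-other R a m x x≢a)))

copy : ℕ → ℕ → ℕ → Code
copy a d t = clear d ⨾ clear t ⨾ move₂ a d t ⨾ move t a

copy-correct : ∀ {e r} a d t b → a ≢ d → a ≢ t → d ≢ t → LoadedAt e b (copy a d t b) → ∀ R → ∃ λ R′ →
  Reach e r b R (end (copy a d t) b) R′ × R′ d ≡ R a × R′ t ≡ 0 × (∀ x → x ≢ d → x ≢ t → R′ x ≡ R x)
copy-correct {e} {r} a d t b a≢d a≢t d≢t L R =
  let R₁ , p₁ , R₁d , frame₁ = clear-correct {e} {r} d b (loaded-⨾ˡ (clear d) cleared L) R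
      R₂ , p₂ , R₂t , frame₂ = clear-correct {e} {r} t (b + 1) (loaded-⨾ˡ (clear t) transferred L₁) R₁
      R₃ , p₃ , R₃a , R₃d , R₃t , frame₃ =
        move₂-correct {e} {r} a d t (b + 1 + 1) a≢d a≢t d≢t (loaded-⨾ˡ (move₂ a d t) restored L₂) R₂
      R₄ , p₄ , R₄t , R₄a , frame₄ =
        move-correct {e} {r} t a (b + 1 + 1 + 3) (≢-sym a≢t) (loaded-⨾ʳ (move₂ a d t) restored L₂) R₃
      R₂a : R₂ a ≡ R a
      R₂a = trans (frame₂ a a≢t) (frame₁ a a≢d)
      R₄a≡Ra : R₄ a ≡ R a
      R₄a≡Ra = trans R₄a (trans (cong (_+ R₃ t) R₃a) (trans R₃t (trans (cong (_+ R₂ a) R₂t) R₂a)))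
  in R₄ ,
     reach-⨾ (clear d) cleared p₁ (reach-⨾ (clear t) transferred p₂ (reach-⨾ (move₂ a d t) restored p₃ p₄)) ,
     trans (frame₄ d d≢t (≢-sym a≢d)) (trans R₃d (trans (cong (_+ R₂ a) (trans (frame₂ d d≢t) R₁d)) R₂a)) ,
     R₄t ,
     λ x x≢d x≢t →
       [ (λ x≡a → subst (λ v → R₄ v ≡ R v) (sym x≡a) R₄a≡Ra)
       , (λ x≢a → trans (frame₄ x x≢t x≢a) (trans (frame₃ x x≢a x≢d x≢t) (trans (frame₂ x x≢t) (frame₁ x x≢d))))
       ]′ (toSum (x ≟ a))
  where
  restored = move t a
  transferred = move₂ a d t ⨾ restored
  cleared = clear t ⨾ transferred
  L₁ = loaded-⨾ʳ (clear d) cleared L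
  L₂ = loaded-⨾ʳ (clear t) transferred L₁

-- Oracle primitive recursive terms and their compilation

natrec : ℕ → ℕ → (ℕ → ℕ → ℕ) → ℕ
natrec zero    a h = a
natrec (suc k) a h = h k (natrec k a h)

natrec-cong : ∀ k a {h h′ : ℕ → ℕ → ℕ} → (∀ c x → h c x ≡ h′ c x) → natrec k a h ≡ natrec k a h′
natrec-cong zero    a eq = refl
natrec-cong (suc k) a {h′ = h′} eq = trans (eq k _) (cong (h′ k) (natrec-cong k a eq))

Env : ℕ → Set
Env = Vector ℕ

data Tm (n : ℕ) : Set where
  var    : Fin n → Tm n
  zer    : Tm n
  succ   : Tm n → Tm n
  oracle : Tm n → Tm n
  rec    : Tm n → Tm n → Tm (2 + n) → Tm n

eval : ∀ {n} → Tm n → Cantor → Env n → ℕ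
eval (var i)     r ρ = ρ i
eval zer         r ρ = 0
eval (succ t)    r ρ = suc (eval t r ρ)
eval (oracle t)  r ρ = if r (eval t r ρ) then 1 else 0
eval (rec t u h) r ρ = natrec (eval t r ρ) (eval u r ρ) (λ c a → eval h r (c ∷ᵛ a ∷ᵛ ρ))

∷ᵛ-cong : ∀ {n} x {ρ ρ′ : Env n} → (∀ i → ρ i ≡ ρ′ i) → ∀ i → (x ∷ᵛ ρ) i ≡ (x ∷ᵛ ρ′) i
∷ᵛ-cong x eq zero    = refl
∷ᵛ-cong x eq (suc i) = eq i

eval-cong : ∀ {n} (t : Tm n) r {ρ ρ′ : Env n} → (∀ i → ρ i ≡ ρ′ i) → eval t r ρ ≡ eval t r ρ′
eval-cong (var i)     r eq = eq i
eval-cong zer         r eq = refl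
eval-cong (succ t)    r eq = cong suc (eval-cong t r eq)
eval-cong (oracle t)  r eq = cong (λ v → if r v then 1 else 0) (eval-cong t r eq)
eval-cong (rec t u h) r eq =
  trans (cong₂ (λ k a → natrec k a _) (eval-cong t r eq) (eval-cong u r eq))
        (natrec-cong (eval t r _) (eval u r _) λ c a → eval-cong h r (∷ᵛ-cong c (∷ᵛ-cong a eq)))

increment : ℕ → Code
increment a b = inc a (b + 1) ∷ []

query : ℕ → ℕ → Code
query a s b = orc a s (b + 1) ∷ []

increment-goto : ℕ → ℕ → Code
increment-goto a j _ = inc a j ∷ []

-- compile t ρ o s: the variables of t live in the registers ρ, the value goes to register o,
-- and registers from s upwards are scratch space
compile : ∀ {n} → Tm n → (Fin n → ℕ) → ℕ → ℕ → Code
loop-body : ∀ {n} → Tm (2 + n) → (Fin n → ℕ) → ℕ → ℕ → Code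
loop : ∀ {n} → Tm (2 + n) → (Fin n → ℕ) → ℕ → Code

compile (var i)     ρ o s = copy (ρ i) o s
compile zer         ρ o s = clear o
compile (succ t)    ρ o s = compile t ρ o s ⨾ increment o
compile (oracle t)  ρ o s = compile t ρ s (1 + s) ⨾ query o s
compile (rec t u h) ρ o s =
  compile t ρ (2 + s) (3 + s) ⨾ compile u ρ s (3 + s) ⨾ clear (1 + s) ⨾ loop h ρ s ⨾ copy s o (1 + s)

-- counter in 2+s, index in 1+s, accumulator in s
loop-body h ρ s head = compile h ((1 + s) ∷ᵛ s ∷ᵛ ρ) (3 + s) (4 + s) ⨾ clear s ⨾ move (3 + s) s ⨾ increment-goto (1 + s) head

loop h ρ s b = dec (2 + s) (b + 1) (b + suc (length (loop-body h ρ s b (b + 1)))) ∷ loop-body h ρ s b (b + 1)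

record Evaluates (e : Program) (r : Cantor) (c : Code) (b : ℕ) (R : Regs) (o s v : ℕ) : Set where
  constructor evaluates
  field
    final  : Regs
    reach  : Reach e r b R (end c b) final
    output : final o ≡ v
    frame  : ∀ x → x < s → x ≢ o → final x ≡ R x

<-+ˡ : ∀ {x s} k → x < s → x < k + s
<-+ˡ {s = s} k x<s = <-≤-trans x<s (m≤n+m s k)

<⇒≢-+ˡ : ∀ {x s} k → x < s → x ≢ k + s
<⇒≢-+ˡ k x<s = <⇒≢ (<-+ˡ k x<s)

+ʳ-≢ : ∀ {i j} s → i ≢ j → i + s ≢ j + s
+ʳ-≢ s i≢j eq = i≢j (+-cancelʳ-≡ s _ _ eq)

module Loop {n} {e r} (h : Tm (2 + n)) (ρ : Fin n → ℕ) (s b : ℕ) (R : Regs) (a : ℕ)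
  (ρ<s : ∀ i → ρ i < s) (L : LoadedAt e b (loop h ρ s b))
  (body-correct : ∀ R′ → Evaluates e r (compile h ((1 + s) ∷ᵛ s ∷ᵛ ρ) (3 + s) (4 + s)) (b + 1) R′
                                      (3 + s) (4 + s) (eval h r (R′ ∘ ((1 + s) ∷ᵛ s ∷ᵛ ρ)))) where

  H : ℕ → ℕ → ℕ
  H c x = eval h r (c ∷ᵛ x ∷ᵛ (R ∘ ρ))

  ρ′ : Fin (2 + n) → ℕ
  ρ′ = (1 + s) ∷ᵛ s ∷ᵛ ρ

  hcode back rest₁ rest₂ : Code
  hcode = compile h ρ′ (3 + s) (4 + s)
  back  = increment-goto (1 + s) b
  rest₂ = move (3 + s) s ⨾ back
  rest₁ = clear s ⨾ rest₂

  body-loaded : LoadedAt e (b + 1) ((hcode ⨾ rest₁) (b + 1))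
  body-loaded = loaded-tail L

  Invariant : ℕ → Regs → Set
  Invariant j R₀ = R₀ (1 + s) ≡ j × R₀ s ≡ natrec j a H × (∀ x → x < s → R₀ x ≡ R x)

  iteration : ∀ m j R₀ → R₀ (2 + s) ≡ suc m → Invariant j R₀ →
              ∃ λ R′ → Reach e r b R₀ b R′ × R′ (2 + s) ≡ m × Invariant (suc j) R′
  iteration m j R₀ counter (index , acc , frame)
    with body-correct (set! R₀ (2 + s) m)
  ... | evaluates R₂ p₂ out₂ frame₂
    with clear-correct {e} {r} s (end hcode (b + 1)) (loaded-⨾ˡ (clear s) rest₂ (loaded-⨾ʳ hcode rest₁ body-loaded)) R₂
  ... | R₃ , p₃ , R₃s , frame₃
    with move-correct {e} {r} (3 + s) s (end hcode (b + 1) + 1) (+ʳ-≢ s λ ())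
           (loaded-⨾ˡ (move (3 + s) s) back (loaded-⨾ʳ (clear s) rest₂ (loaded-⨾ʳ hcode rest₁ body-loaded))) R₃
  ... | R₄ , p₄ , _ , R₄s , frame₄ =
    set! R₄ (1 + s) (suc (R₄ (1 + s))) ,
    reach-trans (step-dec-suc (loaded-head L) counter)
      (reach-trans p₂ (reach-trans p₃ (reach-trans p₄
        (step-inc (loaded-head (loaded-⨾ʳ (move (3 + s) s) back (loaded-⨾ʳ (clear s) rest₂ (loaded-⨾ʳ hcode rest₁ body-loaded)))))))) ,
    trans (set!-other R₄ (1 + s) _ (2 + s) (+ʳ-≢ s λ ())) (trans (body-frame (2 + s) (n<1+n (2 + s)) (+ʳ-≢ s λ ()))
      (set!-same R₀ (2 + s) m)) ,
    trans (set!-same R₄ (1 + s) _) (cong suc (trans (body-frame (1 + s) (m<n⇒m<1+n (n<1+n (1 + s))) (+ʳ-≢ s λ ()))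
      (trans (set!-other R₀ (2 + s) m (1 + s) (+ʳ-≢ s λ ())) index))) ,
    trans (set!-other R₄ (1 + s) _ s (+ʳ-≢ s λ ())) accumulated ,
    λ x x<s → trans (set!-other R₄ (1 + s) _ x (<⇒≢-+ˡ 1 x<s))
      (trans (body-frame x (<-+ˡ 3 x<s) (<⇒≢ x<s)) (trans (set!-other R₀ (2 + s) m x (<⇒≢-+ˡ 2 x<s)) (frame x x<s)))
    where
    R₁ = set! R₀ (2 + s) m
    body-frame : ∀ x → x < 3 + s → x ≢ s → R₄ x ≡ R₁ x
    body-frame x x<3+s x≢s =
      trans (frame₄ x (<⇒≢ x<3+s) x≢s) (trans (frame₃ x x≢s) (frame₂ x (m<n⇒m<1+n x<3+s) (<⇒≢ x<3+s)))
    environment : ∀ i → R₁ (ρ′ i) ≡ (j ∷ᵛ natrec j a H ∷ᵛ (R ∘ ρ)) i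
    environment zero          = trans (set!-other R₀ (2 + s) m (1 + s) (+ʳ-≢ s λ ())) index
    environment (suc zero)    = trans (set!-other R₀ (2 + s) m s (+ʳ-≢ s λ ())) acc
    environment (suc (suc i)) = trans (set!-other R₀ (2 + s) m (ρ i) (<⇒≢-+ˡ 2 (ρ<s i))) (frame (ρ i) (ρ<s i))
    accumulated : R₄ s ≡ natrec (suc j) a H
    accumulated = trans R₄s (trans (cong (_+ R₃ (3 + s)) R₃s)
                    (trans (frame₃ (3 + s) (+ʳ-≢ s λ ())) (trans out₂ (eval-cong h r environment))))

  loop-correct : ∀ m j R₀ → R₀ (2 + s) ≡ m → Invariant j R₀ → ∃ λ R′ →
    Reach e r b R₀ (end (loop h ρ s) b) R′ × R′ s ≡ natrec (j + m) a H × (∀ x → x < s → R′ x ≡ R x)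
  loop-correct zero j R₀ counter (_ , acc , frame) =
    R₀ , step-dec-zero (loaded-head L) counter , trans acc (cong (λ k → natrec k a H) (sym (+-identityʳ j))) , frame
  loop-correct (suc m) j R₀ counter inv =
    let R₁ , p , counter₁ , inv₁ = iteration m j R₀ counter inv
        R′ , q , acc , frame = loop-correct m (suc j) R₁ counter₁ inv₁
    in R′ , reach-trans p q , trans acc (cong (λ k → natrec k a H) (sym (+-suc j m))) , frame

compile-correct : ∀ {n e r} (t : Tm n) (ρ : Fin n → ℕ) o s b →
  (∀ i → ρ i < s) → o < s → (∀ i → ρ i ≢ o) → LoadedAt e b (compile t ρ o s b) → ∀ R →
  Evaluates e r (compile t ρ o s) b R o s (eval t r (R ∘ ρ))
compile-correct (var i) ρ o s b ρ<s o<s ρ≢o L R =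
  let R′ , p , R′o , _ , frame = copy-correct (ρ i) o s b (ρ≢o i) (<⇒≢ (ρ<s i)) (<⇒≢ o<s) L R
  in evaluates R′ p R′o λ x x<s x≢o → frame x x≢o (<⇒≢ x<s)
compile-correct zer ρ o s b _ _ _ L R =
  let R′ , p , R′o , frame = clear-correct o b L R
  in evaluates R′ p R′o λ x _ x≢o → frame x x≢o
compile-correct (succ t) ρ o s b ρ<s o<s ρ≢o L R =
  let evaluates R₁ p R₁o frame =
        compile-correct t ρ o s b ρ<s o<s ρ≢o (loaded-⨾ˡ (compile t ρ o s) (increment o) L) R
  in evaluates (set! R₁ o (suc (R₁ o)))
       (reach-⨾ (compile t ρ o s) (increment o) p
         (step-inc (loaded-head (loaded-⨾ʳ (compile t ρ o s) (increment o) L))))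
       (trans (set!-same R₁ o _) (cong suc R₁o))
       λ x x<s x≢o → trans (set!-other R₁ o _ x x≢o) (frame x x<s x≢o)
compile-correct {r = r} (oracle t) ρ o s b ρ<s o<s ρ≢o L R =
  let evaluates R₁ p R₁s frame =
        compile-correct t ρ s (1 + s) b (λ i → <-+ˡ 1 (ρ<s i)) (n<1+n s) (λ i → <⇒≢ (ρ<s i))
          (loaded-⨾ˡ (compile t ρ s (1 + s)) (query o s) L) R
  in evaluates (set! R₁ o (if r (R₁ s) then 1 else 0))
       (reach-⨾ (compile t ρ s (1 + s)) (query o s) p
         (step-orc (loaded-head (loaded-⨾ʳ (compile t ρ s (1 + s)) (query o s) L))))
       (trans (set!-same R₁ o _) (cong (λ v → if r v then 1 else 0) R₁s))
       λ x x<s x≢o → trans (set!-other R₁ o _ x x≢o) (frame x (<-+ˡ 1 x<s) (<⇒≢ x<s))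
compile-correct {n} {e} {r} (rec t u h) ρ o s b ρ<s o<s ρ≢o L R =
  let evaluates R₁ p₁ out₁ frame₁ =
        compile-correct t ρ (2 + s) (3 + s) b (λ i → <-+ˡ 3 (ρ<s i)) (n<1+n (2 + s)) (λ i → <⇒≢-+ˡ 2 (ρ<s i)) L₁ R
      evaluates R₂ p₂ out₂ frame₂ =
        compile-correct u ρ s (3 + s) b₁ (λ i → <-+ˡ 3 (ρ<s i)) (<-+ˡ 2 (n<1+n s)) (λ i → <⇒≢ (ρ<s i)) L₂ R₁
      R₃ , p₃ , R₃i , frame₃ = clear-correct (1 + s) b₂ L₃ R₂
      counter : R₃ (2 + s) ≡ eval t r env
      counter = trans (frame₃ (2 + s) (+ʳ-≢ s λ ())) (trans (frame₂ (2 + s) (n<1+n (2 + s)) (+ʳ-≢ s λ ())) out₁)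
      initial-acc : R₃ s ≡ eval u r env
      initial-acc = trans (frame₃ s (+ʳ-≢ s λ ())) (trans out₂ (eval-cong u r λ i →
                      frame₁ (ρ i) (<-+ˡ 3 (ρ<s i)) (<⇒≢-+ˡ 2 (ρ<s i))))
      R₄ , p₄ , out₄ , frame₄ =
        Loop.loop-correct h ρ s b₃ R (eval u r env) ρ<s L₄ body-correct (eval t r env) 0 R₃ counter
          (R₃i , initial-acc , λ x x<s → trans (frame₃ x (<⇒≢-+ˡ 1 x<s))
                                          (trans (frame₂ x (<-+ˡ 3 x<s) (<⇒≢ x<s)) (frame₁ x (<-+ˡ 3 x<s) (<⇒≢-+ˡ 2 x<s))))
      R₅ , p₅ , out₅ , _ , frame₅ =
        copy-correct s o (1 + s) b₄ (≢-sym (<⇒≢ o<s)) (+ʳ-≢ s λ ()) (<⇒≢-+ˡ 1 o<s) L₅ R₄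
  in evaluates R₅
       (reach-⨾ tcode (ucode ⨾ ccode ⨾ lcode ⨾ pcode) p₁ (reach-⨾ ucode (ccode ⨾ lcode ⨾ pcode) p₂
         (reach-⨾ ccode (lcode ⨾ pcode) p₃ (reach-⨾ lcode pcode p₄ p₅))))
       (trans out₅ out₄)
       λ x x<s x≢o → trans (frame₅ x x≢o (<⇒≢-+ˡ 1 x<s)) (frame₄ x x<s)
  where
  env = R ∘ ρ
  tcode = compile t ρ (2 + s) (3 + s)
  ucode = compile u ρ s (3 + s)
  ccode = clear (1 + s)
  lcode = loop h ρ s
  pcode = copy s o (1 + s)
  b₁ = end tcode b
  b₂ = end ucode b₁
  b₃ = end ccode b₂
  b₄ = end lcode b₃
  L₁ = loaded-⨾ˡ tcode (ucode ⨾ ccode ⨾ lcode ⨾ pcode) L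
  L₂′ = loaded-⨾ʳ tcode (ucode ⨾ ccode ⨾ lcode ⨾ pcode) L
  L₂ = loaded-⨾ˡ ucode (ccode ⨾ lcode ⨾ pcode) L₂′
  L₃′ = loaded-⨾ʳ ucode (ccode ⨾ lcode ⨾ pcode) L₂′
  L₃ = loaded-⨾ˡ ccode (lcode ⨾ pcode) L₃′
  L₄′ = loaded-⨾ʳ ccode (lcode ⨾ pcode) L₃′
  L₄ = loaded-⨾ˡ lcode pcode L₄′
  L₅ = loaded-⨾ʳ lcode pcode L₄′
  ρ′ = (1 + s) ∷ᵛ s ∷ᵛ ρ
  ρ′<4+s : ∀ i → ρ′ i < 4 + s
  ρ′<4+s zero          = <-+ˡ 2 (n<1+n (1 + s))
  ρ′<4+s (suc zero)    = <-+ˡ 3 (n<1+n s)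
  ρ′<4+s (suc (suc i)) = <-+ˡ 4 (ρ<s i)
  ρ′≢3+s : ∀ i → ρ′ i ≢ 3 + s
  ρ′≢3+s zero          = +ʳ-≢ s λ ()
  ρ′≢3+s (suc zero)    = +ʳ-≢ s λ ()
  ρ′≢3+s (suc (suc i)) = <⇒≢-+ˡ 3 (ρ<s i)
  body-correct : ∀ R′ → Evaluates e r (compile h ρ′ (3 + s) (4 + s)) (b₃ + 1) R′ (3 + s) (4 + s) (eval h r (R′ ∘ ρ′))
  body-correct = compile-correct h ρ′ (3 + s) (4 + s) (b₃ + 1) ρ′<4+s (n<1+n (3 + s)) ρ′≢3+s
                   (loaded-⨾ˡ (compile h ρ′ (3 + s) (4 + s)) (clear s ⨾ move (3 + s) s ⨾ increment-goto (1 + s) b₃)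
                     (loaded-tail L₄))


-- the input arrives in register 0, where the output is also expected, so it is first copied to register 1
program : Tm 1 → Program
program t = (copy 0 1 2 ⨾ compile t (λ _ → 1) 0 2) 0

program-computes : (t : Tm 1) (f : Cantor → ℕ → Bool) → (∀ r n → eval t r (λ _ → n) ≡ bit (f r n)) →
  ∀ r → Computes (program t) r (f r)
program-computes t f t≡f r n = Reach.steps reach′ , halts
  where
  e = program t
  input = copy 0 1 2
  body = compile t (λ _ → 1) 0 2
  L : LoadedAt e 0 e
  L = loaded λ _ _ → refl
  copied = copy-correct {e} {r} 0 1 2 0 (λ ()) (λ ()) (λ ()) (loaded-⨾ˡ input body L) (proj₂ (initial n))
  evaluated = compile-correct t (λ _ → 1) 0 2 (end input 0) (λ _ → s≤s (s≤s z≤n)) (s≤s z≤n) (λ _ ())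
                (loaded-⨾ʳ input body L) (proj₁ copied)
  open Evaluates evaluated
  reach′ : Reach e r 0 (proj₂ (initial n)) (length e) final
  reach′ = reach-⨾ input body (proj₁ (proj₂ copied)) reach
  halts : let c = run e r (Reach.steps reach′) (initial n) in (fetch e (proj₁ c) ≡ nothing) × (proj₂ c zero ≡ bit (f r n))
  halts rewrite Reach.runs reach′ =
    fetch-length e , trans output (trans (eval-cong t r λ _ → proj₁ (proj₂ (proj₂ copied))) (t≡f r n))

-- Oracle primitive recursive functions

liftʳ : ∀ {m n} → (Fin m → Fin n) → Fin (suc m) → Fin (suc n)
liftʳ f zero    = zero
liftʳ f (suc i) = suc (f i)

rename : ∀ {m n} → (Fin m → Fin n) → Tm m → Tm n
rename f (var i)     = var (f i)
rename f zer         = zer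
rename f (succ t)    = succ (rename f t)
rename f (oracle t)  = oracle (rename f t)
rename f (rec t u h) = rec (rename f t) (rename f u) (rename (liftʳ (liftʳ f)) h)

eval-rename : ∀ {m n} (f : Fin m → Fin n) t r (ρ : Env n) → eval (rename f t) r ρ ≡ eval t r (ρ ∘ f)
eval-rename f (var i)     r ρ = refl
eval-rename f zer         r ρ = refl
eval-rename f (succ t)    r ρ = cong suc (eval-rename f t r ρ)
eval-rename f (oracle t)  r ρ = cong (λ v → if r v then 1 else 0) (eval-rename f t r ρ)
eval-rename f (rec t u h) r ρ =
  trans (cong₂ (λ k a → natrec k a _) (eval-rename f t r ρ) (eval-rename f u r ρ))
    (natrec-cong (eval t r (ρ ∘ f)) (eval u r (ρ ∘ f)) λ c a →
      trans (eval-rename (liftʳ (liftʳ f)) h r (c ∷ᵛ a ∷ᵛ ρ)) (eval-cong h r lifted))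
  where
  lifted : ∀ {c a} i → ((c ∷ᵛ a ∷ᵛ ρ) ∘ liftʳ (liftʳ f)) i ≡ (c ∷ᵛ a ∷ᵛ (ρ ∘ f)) i
  lifted zero          = refl
  lifted (suc zero)    = refl
  lifted (suc (suc i)) = refl

liftˢ : ∀ {m n} → (Fin m → Tm n) → Fin (suc m) → Tm (suc n)
liftˢ σ zero    = var zero
liftˢ σ (suc i) = rename suc (σ i)

substitute : ∀ {m n} → (Fin m → Tm n) → Tm m → Tm n
substitute σ (var i)     = σ i
substitute σ zer         = zer
substitute σ (succ t)    = succ (substitute σ t)
substitute σ (oracle t)  = oracle (substitute σ t)
substitute σ (rec t u h) = rec (substitute σ t) (substitute σ u) (substitute (liftˢ (liftˢ σ)) h)

eval-substitute : ∀ {m n} (σ : Fin m → Tm n) t r (ρ : Env n) →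
  eval (substitute σ t) r ρ ≡ eval t r (λ i → eval (σ i) r ρ)
eval-substitute σ (var i)     r ρ = refl
eval-substitute σ zer         r ρ = refl
eval-substitute σ (succ t)    r ρ = cong suc (eval-substitute σ t r ρ)
eval-substitute σ (oracle t)  r ρ = cong (λ v → if r v then 1 else 0) (eval-substitute σ t r ρ)
eval-substitute σ (rec t u h) r ρ =
  trans (cong₂ (λ k a → natrec k a _) (eval-substitute σ t r ρ) (eval-substitute σ u r ρ))
    (natrec-cong (eval t r (λ i → eval (σ i) r ρ)) (eval u r (λ i → eval (σ i) r ρ)) λ c a →
      trans (eval-substitute (liftˢ (liftˢ σ)) h r (c ∷ᵛ a ∷ᵛ ρ)) (eval-cong h r lifted))
  where
  lifted : ∀ {c a} i → eval (liftˢ (liftˢ σ) i) r (c ∷ᵛ a ∷ᵛ ρ) ≡ (c ∷ᵛ a ∷ᵛ (λ i → eval (σ i) r ρ)) i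
  lifted zero          = refl
  lifted (suc zero)    = refl
  lifted {c} {a} (suc (suc i)) =
    trans (eval-rename suc (rename suc (σ i)) r (c ∷ᵛ a ∷ᵛ ρ)) (eval-rename suc (σ i) r (a ∷ᵛ ρ))

OracleFn : ℕ → Set
OracleFn n = Cantor → Env n → ℕ

record PR (n : ℕ) (f : OracleFn n) : Set where
  constructor pr
  field
    term      : Tm n
    eval-term : ∀ r ρ → eval term r ρ ≡ f r ρ
open PR public

pr-cast : ∀ {n} {f g : OracleFn n} → (∀ r ρ → f r ρ ≡ g r ρ) → PR n f → PR n g
pr-cast f≡g (pr t ok) = pr t (λ r ρ → trans (ok r ρ) (f≡g r ρ))

pr-cong : ∀ {n f} → PR n f → ∀ r {ρ ρ′ : Env n} → (∀ i → ρ i ≡ ρ′ i) → f r ρ ≡ f r ρ′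
pr-cong (pr t ok) r {ρ} {ρ′} eq = trans (sym (ok r ρ)) (trans (eval-cong t r eq) (ok r ρ′))

pr-var : ∀ {n} (i : Fin n) → PR n (λ r ρ → ρ i)
pr-var i = pr (var i) (λ r ρ → refl)

v₀ : ∀ {n} → PR (1 + n) (λ r ρ → ρ zero)
v₀ = pr-var zero

v₁ : ∀ {n} → PR (2 + n) (λ r ρ → ρ (suc zero))
v₁ = pr-var (suc zero)

v₂ : ∀ {n} → PR (3 + n) (λ r ρ → ρ (suc (suc zero)))
v₂ = pr-var (suc (suc zero))

pr-zero : ∀ {n} → PR n (λ r ρ → 0)
pr-zero = pr zer (λ r ρ → refl)

pr-suc : ∀ {n f} → PR n f → PR n (λ r ρ → suc (f r ρ))
pr-suc (pr t ok) = pr (succ t) (λ r ρ → cong suc (ok r ρ))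

pr-oracle : ∀ {n f} → PR n f → PR n (λ r ρ → if r (f r ρ) then 1 else 0)
pr-oracle (pr t ok) = pr (oracle t) (λ r ρ → cong (λ v → if r v then 1 else 0) (ok r ρ))

pr-natrec : ∀ {n} {f g : OracleFn n} {h : OracleFn (2 + n)} → PR n f → PR n g → PR (2 + n) h →
  PR n (λ r ρ → natrec (f r ρ) (g r ρ) (λ c a → h r (c ∷ᵛ a ∷ᵛ ρ)))
pr-natrec {f = f} {g} (pr t okt) (pr u oku) (pr hh okh) =
  pr (rec t u hh) (λ r ρ → trans (cong₂ (λ k a → natrec k a _) (okt r ρ) (oku r ρ))
                                (natrec-cong (f r ρ) (g r ρ) (λ c a → okh r (c ∷ᵛ a ∷ᵛ ρ))))

pr-substitute : ∀ {m n} {g : OracleFn m} {σ : Fin m → OracleFn n} → PR m g → (∀ i → PR n (σ i)) →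
  PR n (λ r ρ → g r (λ i → σ i r ρ))
pr-substitute (pr t ok) σ =
  pr (substitute (term ∘ σ) t)
     (λ r ρ → trans (eval-substitute _ t r ρ) (trans (eval-cong t r (λ i → eval-term (σ i) r ρ)) (ok r _)))

pr-rename : ∀ {m n f} (g : Fin m → Fin n) → PR m f → PR n (λ r ρ → f r (ρ ∘ g))
pr-rename g (pr t ok) = pr (rename g t) (λ r ρ → trans (eval-rename g t r ρ) (ok r (ρ ∘ g)))

pr-∘₁ : ∀ {n} {F : Cantor → ℕ → ℕ} {a : OracleFn n} →
  PR 1 (λ r ρ → F r (ρ zero)) → PR n a → PR n (λ r ρ → F r (a r ρ))
pr-∘₁ PF Pa = pr-substitute PF (λ _ → Pa)

pr-∘₂ : ∀ {n} {F : Cantor → ℕ → ℕ → ℕ} {a b : OracleFn n} →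
  PR 2 (λ r ρ → F r (ρ zero) (ρ (suc zero))) → PR n a → PR n b → PR n (λ r ρ → F r (a r ρ) (b r ρ))
pr-∘₂ {n} {F} {a} {b} PF Pa Pb = pr-substitute {σ = args} PF pr-args
  where
  args : Fin 2 → OracleFn n
  args zero    = a
  args (suc _) = b
  pr-args : ∀ i → PR n (args i)
  pr-args zero       = Pa
  pr-args (suc zero) = Pb

pr-∘₃ : ∀ {n} {F : Cantor → ℕ → ℕ → ℕ → ℕ} {a b c : OracleFn n} →
  PR 3 (λ r ρ → F r (ρ zero) (ρ (suc zero)) (ρ (suc (suc zero)))) → PR n a → PR n b → PR n c →
  PR n (λ r ρ → F r (a r ρ) (b r ρ) (c r ρ))
pr-∘₃ {n} {F} {a} {b} {c} PF Pa Pb Pc = pr-substitute {σ = args} PF pr-args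
  where
  args : Fin 3 → OracleFn n
  args zero          = a
  args (suc zero)    = b
  args (suc (suc _)) = c
  pr-args : ∀ i → PR n (args i)
  pr-args zero             = Pa
  pr-args (suc zero)       = Pb
  pr-args (suc (suc zero)) = Pc

pr-const : ∀ {n} k → PR n (λ r ρ → k)
pr-const zero    = pr-zero
pr-const (suc k) = pr-suc (pr-const k)

pr-+ : ∀ {n} {a b : OracleFn n} → PR n a → PR n b → PR n (λ r ρ → a r ρ + b r ρ)
pr-+ = pr-∘₂ {F = λ r x y → x + y}
  (pr-cast (λ r ρ → natrec-suc (ρ (suc zero)) (ρ zero)) (pr-natrec v₁ v₀ (pr-suc v₁)))
  where
  natrec-suc : ∀ k a → natrec k a (λ _ x → suc x) ≡ a + k
  natrec-suc zero    a = sym (+-identityʳ a)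
  natrec-suc (suc k) a = trans (cong suc (natrec-suc k a)) (sym (+-suc a k))

pr-pred : ∀ {n} {a : OracleFn n} → PR n a → PR n (λ r ρ → a r ρ ∸ 1)
pr-pred = pr-∘₁ {F = λ r x → x ∸ 1} (pr-cast (λ r ρ → natrec-pred (ρ zero)) (pr-natrec v₀ pr-zero v₀))
  where
  natrec-pred : ∀ k → natrec k 0 (λ c _ → c) ≡ k ∸ 1
  natrec-pred zero    = refl
  natrec-pred (suc k) = refl

pr-∸ : ∀ {n} {a b : OracleFn n} → PR n a → PR n b → PR n (λ r ρ → a r ρ ∸ b r ρ)
pr-∸ = pr-∘₂ {F = λ r x y → x ∸ y}
  (pr-cast (λ r ρ → natrec-∸ (ρ (suc zero)) (ρ zero)) (pr-natrec v₁ v₀ (pr-pred v₁)))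
  where
  natrec-∸ : ∀ k a → natrec k a (λ _ x → x ∸ 1) ≡ a ∸ k
  natrec-∸ zero    a = refl
  natrec-∸ (suc k) a = trans (cong (_∸ 1) (natrec-∸ k a)) (trans (∸-+-assoc a k 1) (cong (a ∸_) (+-comm k 1)))

pr-2^ : ∀ {n} {a : OracleFn n} → PR n a → PR n (λ r ρ → 2 ^ a r ρ)
pr-2^ = pr-∘₁ {F = λ r x → 2 ^ x} (pr-cast (λ r ρ → natrec-2^ (ρ zero)) (pr-natrec v₀ (pr-const 1) (pr-+ v₁ v₁)))
  where
  natrec-2^ : ∀ k → natrec k 1 (λ _ a → a + a) ≡ 2 ^ k
  natrec-2^ zero    = refl
  natrec-2^ (suc k) = trans (cong (λ v → v + v) (natrec-2^ k)) (cong (2 ^ k +_) (sym (+-identityʳ (2 ^ k))))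

ifz : ℕ → ℕ → ℕ → ℕ
ifz zero    a b = a
ifz (suc _) a b = b

pr-ifz : ∀ {n} {c a b : OracleFn n} → PR n c → PR n a → PR n b → PR n (λ r ρ → ifz (c r ρ) (a r ρ) (b r ρ))
pr-ifz = pr-∘₃ {F = λ r x y z → ifz x y z}
  (pr-cast (λ r ρ → natrec-ifz (ρ zero) (ρ (suc zero)) (ρ (suc (suc zero))))
    (pr-natrec v₀ v₁ (pr-var (suc (suc (suc (suc zero)))))))
  where
  natrec-ifz : ∀ k a b → natrec k a (λ _ _ → b) ≡ ifz k a b
  natrec-ifz zero    a b = refl
  natrec-ifz (suc k) a b = refl

OraclePred : ℕ → Set
OraclePred n = Cantor → Env n → Bool

PRᵇ : (n : ℕ) → OraclePred n → Set
PRᵇ n P = PR n (λ r ρ → bit (P r ρ))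

pr-∧ : ∀ {n} {P Q : OraclePred n} → PRᵇ n P → PRᵇ n Q → PRᵇ n (λ r ρ → P r ρ ∧ Q r ρ)
pr-∧ {P = P} {Q} PP PQ = pr-cast (λ r ρ → ifz-∧ (P r ρ) (Q r ρ)) (pr-ifz PP pr-zero PQ)
  where
  ifz-∧ : ∀ a b → ifz (bit a) 0 (bit b) ≡ bit (a ∧ b)
  ifz-∧ true  b = refl
  ifz-∧ false b = refl

pr-∨ : ∀ {n} {P Q : OraclePred n} → PRᵇ n P → PRᵇ n Q → PRᵇ n (λ r ρ → P r ρ ∨ Q r ρ)
pr-∨ {P = P} {Q} PP PQ = pr-cast (λ r ρ → ifz-∨ (P r ρ) (Q r ρ)) (pr-ifz PP PQ (pr-const 1))
  where
  ifz-∨ : ∀ a b → ifz (bit a) (bit b) 1 ≡ bit (a ∨ b)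
  ifz-∨ true  b = refl
  ifz-∨ false b = refl

pr-not : ∀ {n} {P : OraclePred n} → PRᵇ n P → PRᵇ n (λ r ρ → not (P r ρ))
pr-not {P = P} PP = pr-cast (λ r ρ → ifz-not (P r ρ)) (pr-ifz PP (pr-const 1) pr-zero)
  where
  ifz-not : ∀ a → ifz (bit a) 1 0 ≡ bit (not a)
  ifz-not true  = refl
  ifz-not false = refl

pr-if : ∀ {n} {P : OraclePred n} {a b : OracleFn n} → PRᵇ n P → PR n a → PR n b →
  PR n (λ r ρ → if P r ρ then a r ρ else b r ρ)
pr-if {P = P} {a} {b} PP Pa Pb = pr-cast (λ r ρ → ifz-if (P r ρ) (a r ρ) (b r ρ)) (pr-ifz PP Pb Pa)
  where
  ifz-if : ∀ c x y → ifz (bit c) y x ≡ (if c then x else y)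
  ifz-if true  x y = refl
  ifz-if false x y = refl

pr-query : ∀ {n} {a : OracleFn n} → PR n a → PRᵇ n (λ r ρ → r (a r ρ))
pr-query {a = a} Pa = pr-cast (λ r ρ → if-bit (r (a r ρ))) (pr-oracle Pa)
  where
  if-bit : ∀ c → (if c then 1 else 0) ≡ bit c
  if-bit true  = refl
  if-bit false = refl

pr-≡ᵇ : ∀ {n} {a b : OracleFn n} → PR n a → PR n b → PRᵇ n (λ r ρ → a r ρ ≡ᵇ b r ρ)
pr-≡ᵇ {a = a} {b} Pa Pb =
  pr-cast (λ r ρ → ifz-distance (a r ρ) (b r ρ)) (pr-ifz (pr-+ (pr-∸ Pa Pb) (pr-∸ Pb Pa)) (pr-const 1) pr-zero)
  where
  ifz-distance : ∀ a b → ifz ((a ∸ b) + (b ∸ a)) 1 0 ≡ bit (a ≡ᵇ b)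
  ifz-distance zero    zero    = refl
  ifz-distance zero    (suc b) = refl
  ifz-distance (suc a) zero    = refl
  ifz-distance (suc a) (suc b) = ifz-distance a b

even : ℕ → Bool
even zero          = true
even (suc zero)    = false
even (suc (suc n)) = even n

even-suc : ∀ n → even (suc n) ≡ not (even n)
even-suc zero          = refl
even-suc (suc zero)    = refl
even-suc (suc (suc n)) = even-suc n

pr-even : ∀ {n} {a : OracleFn n} → PR n a → PRᵇ n (λ r ρ → even (a r ρ))
pr-even = pr-∘₁ {F = λ r x → bit (even x)}
  (pr-cast (λ r ρ → natrec-even (ρ zero)) (pr-natrec v₀ (pr-const 1) (pr-∸ (pr-const 1) v₁)))
  where
  natrec-even : ∀ k → natrec k 1 (λ _ a → 1 ∸ a) ≡ bit (even k)
  natrec-even zero = refl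
  natrec-even (suc k) rewrite natrec-even k | even-suc k with even k
  ... | true  = refl
  ... | false = refl

all< : ℕ → (ℕ → Bool) → Bool
all< zero    f = true
all< (suc k) f = all< k f ∧ f k

any< : ℕ → (ℕ → Bool) → Bool
any< zero    f = false
any< (suc k) f = any< k f ∨ f k

∧-intro : ∀ {a b} → a ≡ true → b ≡ true → (a ∧ b) ≡ true
∧-intro refl refl = refl

∨-introˡ : ∀ {a b} → a ≡ true → (a ∨ b) ≡ true
∨-introˡ refl = refl

∨-introʳ : ∀ {a b} → b ≡ true → (a ∨ b) ≡ true
∨-introʳ {true}  _ = refl
∨-introʳ {false} e = e

∨-elim : ∀ {a b} → (a ∨ b) ≡ true → a ≡ true ⊎ b ≡ true
∨-elim {true}  _ = inj₁ refl
∨-elim {false} e = inj₂ e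

not-true : ∀ {a} → a ≡ false → not a ≡ true
not-true refl = refl

not-false : ∀ {a} → not a ≡ true → a ≡ false
not-false {false} _ = refl

true≢false : true ≢ false
true≢false ()

all<-elim : ∀ n f → all< n f ≡ true → ∀ j → j < n → f j ≡ true
all<-elim (suc n) f e j j<1+n with m≤n⇒m<n∨m≡n (≤-pred j<1+n)
... | inj₁ j<n  = all<-elim n f (∧-conicalˡ _ _ e) j j<n
... | inj₂ refl = ∧-conicalʳ _ _ e

all<-intro : ∀ n f → (∀ j → j < n → f j ≡ true) → all< n f ≡ true
all<-intro zero    f h = refl
all<-intro (suc n) f h = ∧-intro (all<-intro n f (λ j j<n → h j (m<n⇒m<1+n j<n))) (h n ≤-refl)

any<-elim : ∀ n f → any< n f ≡ true → ∃ λ j → j < n × f j ≡ true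
any<-elim (suc n) f e with any< n f in eq
... | true  = let j , j<n , fj = any<-elim n f eq in j , m<n⇒m<1+n j<n , fj
... | false = n , ≤-refl , e

any<-intro : ∀ n f j → j < n → f j ≡ true → any< n f ≡ true
any<-intro (suc n) f j j<1+n fj with m≤n⇒m<n∨m≡n (≤-pred j<1+n)
... | inj₁ j<n  = ∨-introˡ (any<-intro n f j j<n fj)
... | inj₂ refl = ∨-introʳ {any< j f} fj

-- embeds the context j ∷ ρ of a quantifier body into the context j ∷ acc ∷ ρ of natrec
skip₁ : ∀ {n} → Fin (suc n) → Fin (2 + n)
skip₁ zero    = zero
skip₁ (suc i) = suc (suc i)

pr-all< : ∀ {n} {B : OracleFn n} {P : OraclePred (suc n)} → PR n B → PRᵇ (suc n) P →
  PRᵇ n (λ r ρ → all< (B r ρ) (λ j → P r (j ∷ᵛ ρ)))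
pr-all< {n} {B} {P} PB PP =
  pr-cast (λ r ρ → natrec-all (B r ρ)) (pr-natrec PB (pr-const 1) (pr-ifz v₁ pr-zero (pr-rename skip₁ PP)))
  where
  natrec-all : ∀ {r ρ} k → natrec k 1 (λ c a → ifz a 0 (bit (P r ((c ∷ᵛ a ∷ᵛ ρ) ∘ skip₁)))) ≡ bit (all< k (λ j → P r (j ∷ᵛ ρ)))
  natrec-all zero = refl
  natrec-all {r} {ρ} (suc k) rewrite natrec-all {r} {ρ} k with all< k (λ j → P r (j ∷ᵛ ρ))
  ... | true  = pr-cong PP r λ { zero → refl ; (suc i) → refl }
  ... | false = refl

pr-any< : ∀ {n} {B : OracleFn n} {P : OraclePred (suc n)} → PR n B → PRᵇ (suc n) P →
  PRᵇ n (λ r ρ → any< (B r ρ) (λ j → P r (j ∷ᵛ ρ)))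
pr-any< {n} {B} {P} PB PP =
  pr-cast (λ r ρ → natrec-any (B r ρ)) (pr-natrec PB pr-zero (pr-ifz v₁ (pr-rename skip₁ PP) (pr-const 1)))
  where
  natrec-any : ∀ {r ρ} k → natrec k 0 (λ c a → ifz a (bit (P r ((c ∷ᵛ a ∷ᵛ ρ) ∘ skip₁))) 1) ≡ bit (any< k (λ j → P r (j ∷ᵛ ρ)))
  natrec-any zero = refl
  natrec-any {r} {ρ} (suc k) rewrite natrec-any {r} {ρ} k with any< k (λ j → P r (j ∷ᵛ ρ))
  ... | true  = refl
  ... | false = pr-cong PP r λ { zero → refl ; (suc i) → refl }

≡ᵇ-true : ∀ {a b} → a ≡ b → (a ≡ᵇ b) ≡ true
≡ᵇ-true {a} {b} eq = Equivalence.to T-≡ (≡⇒≡ᵇ a b eq)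

≡ᵇ-sound : ∀ {a b} → (a ≡ᵇ b) ≡ true → a ≡ b
≡ᵇ-sound {a} {b} eq = ≡ᵇ⇒≡ a b (Equivalence.from T-≡ eq)

≡ᵇ-false : ∀ {a b} → a ≢ b → (a ≡ᵇ b) ≡ false
≡ᵇ-false {a} {b} a≢b with a ≡ᵇ b in eq
... | false = refl
... | true  = ⊥-elim (a≢b (≡ᵇ-sound eq))

-- Cantor pairing

pr-triangle : ∀ {n} {a : OracleFn n} → PR n a → PR n (λ r ρ → triangle (a r ρ))
pr-triangle = pr-∘₁ {F = λ r x → triangle x}
  (pr-cast (λ r ρ → natrec-triangle (ρ zero)) (pr-natrec v₀ pr-zero (pr-+ (pr-suc v₀) v₁)))
  where
  natrec-triangle : ∀ d → natrec d 0 (λ c a → suc c + a) ≡ triangle d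
  natrec-triangle zero    = refl
  natrec-triangle (suc d) = cong (suc d +_) (natrec-triangle d)

pr-pair : ∀ {n} {a b : OracleFn n} → PR n a → PR n b → PR n (λ r ρ → pair (a r ρ) (b r ρ))
pr-pair = pr-∘₂ {F = λ r x y → pair x y} (pr-+ (pr-triangle (pr-+ v₀ v₁)) v₁)

-- pair enumerates each diagonal i + m = d by increasing m; the successor of pair 0 m is pair (suc m) 0
unpairʳ : ℕ → ℕ
unpairʳ n = natrec n 0 (λ c m → if triangle m + m ≡ᵇ c then 0 else suc m)

unpairˡ : ℕ → ℕ
unpairˡ n = natrec n 0 (λ c i → if i ≡ᵇ 0 then suc (unpairʳ c) else i ∸ 1)

pr-unpairʳ : ∀ {n} {a : OracleFn n} → PR n a → PR n (λ r ρ → unpairʳ (a r ρ))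
pr-unpairʳ = pr-∘₁ {F = λ r x → unpairʳ x}
  (pr-natrec v₀ pr-zero (pr-if (pr-≡ᵇ (pr-+ (pr-triangle v₁) v₁) v₀) pr-zero (pr-suc v₁)))

pr-unpairˡ : ∀ {n} {a : OracleFn n} → PR n a → PR n (λ r ρ → unpairˡ (a r ρ))
pr-unpairˡ = pr-∘₁ {F = λ r x → unpairˡ x}
  (pr-natrec v₀ pr-zero (pr-if (pr-≡ᵇ v₁ pr-zero) (pr-suc (pr-unpairʳ v₀)) (pr-pred v₁)))

triangle-< : ∀ {d d′} → d < d′ → suc d + triangle d ≤ triangle d′
triangle-< {d} {suc d′} (s≤s d≤d′) with m≤n⇒m<n∨m≡n d≤d′
... | inj₂ refl = ≤-refl
... | inj₁ d<d′ = ≤-trans (triangle-< d<d′) (m≤n+m (triangle d′) (suc d′))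

pair-<-diagonal : ∀ {i m i′ m′} → i + m < i′ + m′ → pair i m < pair i′ m′
pair-<-diagonal {i} {m} {i′} {m′} lt = <-≤-trans
  (s≤s (≤-trans (+-monoʳ-≤ (triangle (i + m)) (m≤n+m m i)) (≤-reflexive (+-comm (triangle (i + m)) (i + m)))))
  (≤-trans (triangle-< lt) (m≤m+n (triangle (i′ + m′)) m′))

pair-unpair : ∀ n → pair (unpairˡ n) (unpairʳ n) ≡ n
pair-unpair zero = refl
pair-unpair (suc n) with unpairˡ n | unpairʳ n | pair-unpair n
... | zero | m | eq rewrite ≡ᵇ-true eq = cong suc (trans diagonal-end eq)
  where
  diagonal-end : m + 0 + triangle (m + 0) + 0 ≡ triangle m + m
  diagonal-end rewrite +-identityʳ m | +-identityʳ (m + triangle m) = +-comm m (triangle m)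
... | suc i | m | eq rewrite ≡ᵇ-false (<⇒≢ (subst (pair 0 m <_) eq (pair-<-diagonal {0} {m} {suc i} {m} (s≤s (m≤n+m m i))))) =
  trans next-on-diagonal (cong suc eq)
  where
  next-on-diagonal : triangle (i + suc m) + suc m ≡ suc (triangle (suc i + m) + m)
  next-on-diagonal rewrite +-suc i m | +-suc (triangle (suc (i + m))) m = refl

pair-injective : ∀ {i m i′ m′} → pair i m ≡ pair i′ m′ → i ≡ i′ × m ≡ m′
pair-injective {i} {m} {i′} {m′} eq with <-cmp (i + m) (i′ + m′)
... | tri< lt _ _ = ⊥-elim (<⇒≢ (pair-<-diagonal {i} {m} {i′} {m′} lt) eq)
... | tri> _ _ gt = ⊥-elim (<⇒≢ (pair-<-diagonal {i′} {m′} {i} {m} gt) (sym eq))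
... | tri≈ _ same _ = i≡i′ , m≡m′
  where
  m≡m′ : m ≡ m′
  m≡m′ = +-cancelˡ-≡ (triangle (i + m)) m m′ (trans eq (cong (λ d → triangle d + m′) (sym same)))
  i≡i′ : i ≡ i′
  i≡i′ = +-cancelʳ-≡ m i i′ (trans same (cong (i′ +_) (sym m≡m′)))

unpairˡ-pair : ∀ i m → unpairˡ (pair i m) ≡ i
unpairˡ-pair i m = proj₁ (pair-injective {unpairˡ (pair i m)} {unpairʳ (pair i m)} {i} {m} (pair-unpair (pair i m)))

unpairʳ-pair : ∀ i m → unpairʳ (pair i m) ≡ m
unpairʳ-pair i m = proj₂ (pair-injective {unpairˡ (pair i m)} {unpairʳ (pair i m)} {i} {m} (pair-unpair (pair i m)))

-- Words as nodes of the complete binary tree, numbered in breadth-first order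

pr-half : ∀ {n} {a : OracleFn n} → PR n a → PR n (λ r ρ → ⌊ a r ρ /2⌋)
pr-half = pr-∘₁ {F = λ r x → ⌊ x /2⌋}
  (pr-cast (λ r ρ → natrec-half (ρ zero)) (pr-natrec v₀ pr-zero (pr-if (pr-even v₀) v₁ (pr-suc v₁))))
  where
  half-suc : ∀ k → ⌊ suc k /2⌋ ≡ (if even k then ⌊ k /2⌋ else suc ⌊ k /2⌋)
  half-suc zero          = refl
  half-suc (suc zero)    = refl
  half-suc (suc (suc k)) with even k | half-suc k
  ... | true  | eq = cong suc eq
  ... | false | eq = cong suc eq
  natrec-half : ∀ k → natrec k 0 (λ c a → if even c then a else suc a) ≡ ⌊ k /2⌋
  natrec-half zero    = refl
  natrec-half (suc k) rewrite natrec-half k = sym (half-suc k)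

child : ℕ → Bool → ℕ
child k b = if b then suc (suc (k + k)) else suc (k + k)

parent : ℕ → ℕ
parent c = ⌊ (c ∸ 1) /2⌋

ancestor : ℕ → ℕ → ℕ
ancestor u i = natrec u i (λ _ a → parent a)

pr-child : ∀ {n} {a : OracleFn n} {b : OraclePred n} → PR n a → PRᵇ n b → PR n (λ r ρ → child (a r ρ) (b r ρ))
pr-child Pa Pb = pr-if Pb (pr-suc (pr-suc (pr-+ Pa Pa))) (pr-suc (pr-+ Pa Pa))

pr-parent : ∀ {n} {a : OracleFn n} → PR n a → PR n (λ r ρ → parent (a r ρ))
pr-parent Pa = pr-half (pr-pred Pa)

pr-ancestor : ∀ {n} {a b : OracleFn n} → PR n a → PR n b → PR n (λ r ρ → ancestor (a r ρ) (b r ρ))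
pr-ancestor = pr-∘₂ {F = λ r x y → ancestor x y} (pr-natrec v₀ v₁ (pr-parent v₁))

even-double : ∀ k → even (k + k) ≡ true
even-double zero    = refl
even-double (suc k) rewrite +-suc k k = even-double k

half-double : ∀ k → ⌊ (k + k) /2⌋ ≡ k
half-double zero    = refl
half-double (suc k) rewrite +-suc k k = cong suc (half-double k)

half-suc-double : ∀ k → ⌊ suc (k + k) /2⌋ ≡ k
half-suc-double zero    = refl
half-suc-double (suc k) rewrite +-suc k k = cong suc (half-suc-double k)

parent-child : ∀ k b → parent (child k b) ≡ k
parent-child k true  = half-suc-double k
parent-child k false = half-double k

even-child : ∀ k b → even (child k b) ≡ b
even-child k true  = even-double k
even-child k false = trans (even-suc (k + k)) (cong not (even-double k))

child-> : ∀ k b → k < child k b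
child-> k true  = s≤s (≤-trans (m≤m+n k k) (n≤1+n _))
child-> k false = s≤s (m≤m+n k k)

child≢0 : ∀ k b → (child k b ≡ᵇ 0) ≡ false
child≢0 k true  = refl
child≢0 k false = refl

ancestor-suc : ∀ u i → ancestor (suc u) i ≡ ancestor u (parent i)
ancestor-suc zero    i = refl
ancestor-suc (suc u) i = cong parent (ancestor-suc u i)

ancestor-+ : ∀ u v i → ancestor (u + v) i ≡ ancestor u (ancestor v i)
ancestor-+ zero    v i = refl
ancestor-+ (suc u) v i = cong parent (ancestor-+ u v i)

ancestor-root : ∀ u → ancestor u 0 ≡ 0
ancestor-root zero    = refl
ancestor-root (suc u) = cong parent (ancestor-root u)

-- ν is the reversal of a little-endian binary counter, so ν (child k b) = ν k ++ [ b ]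
indexLE : Word → ℕ
indexLE []      = 0
indexLE (b ∷ w) = child (indexLE w) b

νLE-children : ∀ k → νLE (child k false) ≡ false ∷ νLE k × νLE (child k true) ≡ true ∷ νLE k
νLE-children zero = refl , refl
νLE-children (suc k) rewrite +-suc k k with νLE-children k
... | left , _ = left′ , cong incLE left′
  where
  left′ : incLE (incLE (νLE (suc (k + k)))) ≡ false ∷ incLE (νLE k)
  left′ rewrite left = refl

νLE-child : ∀ k b → νLE (child k b) ≡ b ∷ νLE k
νLE-child k false = proj₁ (νLE-children k)
νLE-child k true  = proj₂ (νLE-children k)

νLE-indexLE : ∀ w → νLE (indexLE w) ≡ w
νLE-indexLE []      = refl
νLE-indexLE (b ∷ w) = trans (νLE-child (indexLE w) b) (cong (b ∷_) (νLE-indexLE w))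

indexLE-incLE : ∀ w → indexLE (incLE w) ≡ suc (indexLE w)
indexLE-incLE []          = refl
indexLE-incLE (false ∷ w) = refl
indexLE-incLE (true ∷ w) rewrite indexLE-incLE w = cong suc (+-suc (suc (indexLE w)) (indexLE w))

indexLE-νLE : ∀ k → indexLE (νLE k) ≡ k
indexLE-νLE zero    = refl
indexLE-νLE (suc k) = trans (indexLE-incLE (νLE k)) (cong suc (indexLE-νLE k))

index : Word → ℕ
index w = indexLE (reverse w)

index-ν : ∀ k → index (ν k) ≡ k
index-ν k = trans (cong indexLE (reverse-involutive (νLE k))) (indexLE-νLE k)

ν-index : ∀ w → ν (index w) ≡ w
ν-index w = trans (cong reverse (νLE-indexLE (reverse w))) (reverse-involutive w)

index-snoc : ∀ w b → index (w ++ b ∷ []) ≡ child (index w) b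
index-snoc w b = cong indexLE (reverse-++ w (b ∷ []))

node : Cantor → ℕ → ℕ
node p n = index (prefix p n)

node-suc : ∀ p n → node p (suc n) ≡ child (node p n) (p n)
node-suc p n = index-snoc (prefix p n) (p n)

ν-node : ∀ p n → ν (node p n) ≡ prefix p n
ν-node p n = ν-index (prefix p n)

node-≥ : ∀ p n → n ≤ node p n
node-≥ p zero    = z≤n
node-≥ p (suc n) = ≤-trans (s≤s (node-≥ p n)) (subst (node p n <_) (sym (node-suc p n)) (child-> (node p n) (p n)))

ancestor-node : ∀ p N u → u ≤ N → ancestor u (node p N) ≡ node p (N ∸ u)
ancestor-node p N zero    u≤N = refl
ancestor-node p N (suc u) u<N =
  trans (cong parent (ancestor-node p N u (≤-trans (n≤1+n u) u<N)))
    (trans (cong (parent ∘ node p) (+-∸-assoc 1 u<N))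
      (trans (cong parent (node-suc p (N ∸ suc u))) (parent-child (node p (N ∸ suc u)) (p (N ∸ suc u)))))

ancestor-node-root : ∀ p N u → N ≤ u → ancestor u (node p N) ≡ 0
ancestor-node-root p N u N≤u =
  trans (cong (λ v → ancestor v (node p N)) (sym (m∸n+n≡m N≤u)))
    (trans (ancestor-+ (u ∸ N) N (node p N))
      (trans (cong (ancestor (u ∸ N)) (trans (ancestor-node p N N ≤-refl) (cong (node p) (n∸n≡0 N))))
        (ancestor-root (u ∸ N))))

-- Decoding Plotkin's 𝕋

even⇒Even : ∀ n → even n ≡ true → Even n
even⇒Even zero          e = ev0
even⇒Even (suc (suc n)) e = evSS (even⇒Even n e)

Even⇒even : ∀ {n} → Even n → even n ≡ true
Even⇒even ev0      = refl
Even⇒even (evSS e) = Even⇒even e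

¬Even⇒even : ∀ {n} → ¬ Even n → even n ≡ false
¬Even⇒even {n} ¬ev with even n in eq
... | true  = ⊥-elim (¬ev (even⇒Even n eq))
... | false = refl

-- the value of the code of a node that excludes its b-child
exclude : Bool → Tri
exclude true  = zeroT
exclude false = oneT

exclude-injective : ∀ {a b} → exclude a ≡ exclude b → a ≡ b
exclude-injective {true}  {true}  _ = refl
exclude-injective {false} {false} _ = refl

exclude≢botT : ∀ b → exclude b ≢ botT
exclude≢botT true  ()
exclude≢botT false ()

toTri-injective : ∀ {a b} → toTri a ≡ toTri b → a ≡ b
toTri-injective {true}  {true}  _ = refl
toTri-injective {false} {false} _ = refl

FirstOne : Cantor → ℕ → Set
FirstOne q j = q j ≡ true × (∀ i → i < j → q i ≡ false)

FirstOne-unique : ∀ {q j j′} → FirstOne q j → FirstOne q j′ → j ≡ j′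
FirstOne-unique {q} {j} {j′} (qj , before-j) (qj′ , before-j′) with <-cmp j j′
... | tri< j<j′ _ _ = ⊥-elim (true≢false (trans (sym qj) (before-j′ j j<j′)))
... | tri≈ _ j≡j′ _ = j≡j′
... | tri> _ _ j>j′ = ⊥-elim (true≢false (trans (sym qj′) (before-j j′ j>j′)))

δT-FirstOne : ∀ {q v j} → δT q v → FirstOne q j → v ≡ exclude (even j)
δT-FirstOne (bot none) (qj , _) with trans (sym qj) (none _)
... | ()
δT-FirstOne (fst0 n qn before ev) f rewrite FirstOne-unique f (qn , before) | Even⇒even ev = refl
δT-FirstOne (fst1 n qn before ¬ev) f rewrite FirstOne-unique f (qn , before) | ¬Even⇒even ¬ev = refl

δT-≢botT : ∀ {q v} → δT q v → v ≢ botT → ∃ (FirstOne q)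
δT-≢botT (bot _)               v≢⊥ = ⊥-elim (v≢⊥ refl)
δT-≢botT (fst0 n qn before _) _   = n , qn , before
δT-≢botT (fst1 n qn before _) _   = n , qn , before

δT-botT : ∀ {q} → δT q botT → ∀ n → q n ≡ false
δT-botT (bot none) = none

δT-one⇒≢botT : ∀ {q v j} → δT q v → q j ≡ true → v ≢ botT
δT-one⇒≢botT d qj refl = true≢false (trans (sym qj) (δT-botT d _))

δT-cases : ∀ {q v} → δT q v → v ≡ botT ⊎ ∃ (FirstOne q)
δT-cases (bot _)               = inj₁ refl
δT-cases (fst0 n qn before _) = inj₂ (n , qn , before)
δT-cases (fst1 n qn before _) = inj₂ (n , qn , before)

component : Cantor → ℕ → Cantor
component r k j = r (pair k j)

firstOneAt : Cantor → ℕ → ℕ → Bool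
firstOneAt r k j = component r k j ∧ all< j (λ i → not (component r k i))

pr-firstOneAt : ∀ {n} {a b : OracleFn n} → PR n a → PR n b → PRᵇ n (λ r ρ → firstOneAt r (a r ρ) (b r ρ))
pr-firstOneAt = pr-∘₂ {F = λ r x y → bit (firstOneAt r x y)}
  (pr-∧ (pr-query (pr-pair v₀ v₁)) (pr-all< v₁ (pr-not (pr-query (pr-pair v₁ v₀)))))

firstOneAt⇒FirstOne : ∀ r k j → firstOneAt r k j ≡ true → FirstOne (component r k) j
firstOneAt⇒FirstOne r k j e =
  ∧-conicalˡ _ _ e , λ i i<j → not-false (all<-elim j _ (∧-conicalʳ (component r k j) _ e) i i<j)

FirstOne⇒firstOneAt : ∀ r k j → FirstOne (component r k) j → firstOneAt r k j ≡ true
FirstOne⇒firstOneAt r k j (rj , before) = ∧-intro rj (all<-intro j _ λ i i<j → not-true (before i i<j))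

module _ {x : TSeq} {P : PTree} (dP : δPT x P) where

  δPT-root : [] ∈T tree P → x zero ≡ botT
  δPT-root ε∈P with x zero in eq
  ... | botT  = refl
  ... | zeroT = ⊥-elim (true≢false (trans (sym ε∈P) (proj₁ dP (λ ()) [])))
  ... | oneT  = ⊥-elim (true≢false (trans (sym ε∈P) (proj₁ dP (λ ()) [])))

  δPT-child⁺ : ∀ w k b → w ∈T tree P → ν k ≡ w → x zero ≡ botT → x (suc k) ≢ exclude b → (w ++ b ∷ []) ∈T tree P
  δPT-child⁺ w k true  w∈P νk≡w x₀≡⊥ = proj₂ (proj₂ (proj₂ (proj₂ (proj₂ dP x₀≡⊥) w k w∈P νk≡w)))
  δPT-child⁺ w k false w∈P νk≡w x₀≡⊥ = proj₁ (proj₂ (proj₂ (proj₂ dP x₀≡⊥) w k w∈P νk≡w))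

  δPT-child⁻ : ∀ w k b → w ∈T tree P → ν k ≡ w → x zero ≡ botT → (w ++ b ∷ []) ∈T tree P → x (suc k) ≢ exclude b
  δPT-child⁻ w k true  w∈P νk≡w x₀≡⊥ = proj₁ (proj₂ (proj₂ (proj₂ (proj₂ dP x₀≡⊥) w k w∈P νk≡w)))
  δPT-child⁻ w k false w∈P νk≡w x₀≡⊥ = proj₁ (proj₂ (proj₂ dP x₀≡⊥) w k w∈P νk≡w)

δPT-paths : ∀ {x P P′} → δPT x P → δPT x P′ → ∀ p → p ∈[ tree P ] → p ∈[ tree P′ ]
δPT-paths {x} {P} {P′} dP dP′ p p∈P = go
  where
  x₀≡⊥ : x zero ≡ botT
  x₀≡⊥ = δPT-root {x} {P} dP (p∈P 0)
  go : ∀ n → prefix p n ∈T tree P′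
  go zero    = proj₁ (proj₂ dP′ x₀≡⊥)
  go (suc n) = δPT-child⁺ {x} {P′} dP′ (prefix p n) (node p n) (p n) (go n) (ν-node p n) x₀≡⊥
                 (δPT-child⁻ {x} {P} dP (prefix p n) (node p n) (p n) (p∈P n) (ν-node p n) x₀≡⊥ (p∈P (suc n)))

permits : Tri → Bool → Bool
permits zeroT b = not b
permits oneT  b = b
permits botT  _ = true

permits-false : ∀ v → (permits v false ≡ true → v ≢ oneT) × (v ≢ oneT → permits v false ≡ true)
permits-false zeroT = (λ _ ()) , λ _ → refl
permits-false oneT  = (λ ()) , λ v≢1 → ⊥-elim (v≢1 refl)
permits-false botT  = (λ _ ()) , λ _ → refl

permits-true : ∀ v → (permits v true ≡ true → v ≢ zeroT) × (v ≢ zeroT → permits v true ≡ true)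
permits-true zeroT = (λ ()) , λ v≢0 → ⊥-elim (v≢0 refl)
permits-true oneT  = (λ _ ()) , λ _ → refl
permits-true botT  = (λ _ ()) , λ _ → refl

isBotT : Tri → Bool
isBotT botT  = true
isBotT zeroT = false
isBotT oneT  = false

permittedLE : TSeq → Word → Bool
permittedLE y []      = true
permittedLE y (b ∷ w) = permittedLE y w ∧ permits (y (suc (indexLE w))) b

namedSet : TSeq → WordSet
namedSet y w = isBotT (y 0) ∧ permittedLE y (reverse w)

namedSet-closed : ∀ y → PrefixClosed (namedSet y)
namedSet-closed y w v e =
  ∧-intro (∧-conicalˡ _ _ e)
    (permittedLE-suffix (reverse v) (reverse w) (subst (λ u → permittedLE y u ≡ true) (reverse-++ w v) (∧-conicalʳ (isBotT (y 0)) _ e)))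
  where
  permittedLE-suffix : ∀ u w → permittedLE y (u ++ w) ≡ true → permittedLE y w ≡ true
  permittedLE-suffix []      w e = e
  permittedLE-suffix (b ∷ u) w e = permittedLE-suffix u w (∧-conicalˡ _ _ e)

namedSet-snoc : ∀ y w b → namedSet y (w ++ b ∷ []) ≡ namedSet y w ∧ permits (y (suc (index w))) b
namedSet-snoc y w b rewrite reverse-++ w (b ∷ []) = sym (∧-assoc (isBotT (y 0)) (permittedLE y (reverse w)) _)

keptChild : Tri → Bool
keptChild oneT  = true
keptChild zeroT = false
keptChild botT  = false

permits-keptChild : ∀ v → permits v (keptChild v) ≡ true
permits-keptChild zeroT = refl
permits-keptChild oneT  = refl
permits-keptChild botT  = refl

namedTree : TSeq → PTree
namedTree y = mkPT (mkTree (namedSet y) (namedSet-closed y)) λ w w∈ →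
  keptChild (y (suc (index w))) ∷ [] , (λ ()) ,
  trans (namedSet-snoc y w _) (∧-intro w∈ (permits-keptChild (y (suc (index w)))))

δPT-namedTree : ∀ y → δPT y (namedTree y)
δPT-namedTree y = empty , λ y₀≡⊥ → root y₀≡⊥ , λ w n w∈ νn≡w →
  let child₀ = child-permitted w n w∈ νn≡w false
      child₁ = child-permitted w n w∈ νn≡w true
  in proj₁ (permits-false (y (suc n))) ∘ trans (sym child₀) , trans child₀ ∘ proj₂ (permits-false (y (suc n))) ,
     proj₁ (permits-true (y (suc n))) ∘ trans (sym child₁) , trans child₁ ∘ proj₂ (permits-true (y (suc n)))
  where
  empty : y zero ≢ botT → ∀ w → namedSet y w ≡ false
  empty y₀≢⊥ w with y zero
  ... | botT  = ⊥-elim (y₀≢⊥ refl)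
  ... | zeroT = refl
  ... | oneT  = refl
  root : y zero ≡ botT → namedSet y [] ≡ true
  root y₀≡⊥ rewrite y₀≡⊥ = refl
  child-permitted : ∀ w n → namedSet y w ≡ true → ν n ≡ w → ∀ b → namedSet y (w ++ b ∷ []) ≡ permits (y (suc n)) b
  child-permitted w n w∈ νn≡w b =
    trans (namedSet-snoc y w b) (trans (cong (_∧ permits (y (suc (index w))) b) w∈)
      (cong (λ i → permits (y (suc i)) b) (trans (cong index (sym νn≡w)) (index-ν n))))

childrenName : Bool → Bool → Tri
childrenName true  true  = botT
childrenName true  false = zeroT
childrenName false true  = oneT
childrenName false false = botT

nameOf : PTree → TSeq
nameOf P zero    = if set (tree P) [] then botT else zeroT
nameOf P (suc k) = childrenName (set (tree P) (ν k ++ false ∷ [])) (set (tree P) (ν k ++ true ∷ []))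

childrenName-false : ∀ a b → (a ≡ false → b ≡ false → ⊥) →
  (a ≡ true → childrenName a b ≢ oneT) × (childrenName a b ≢ oneT → a ≡ true)
childrenName-false true  true  _ = (λ _ ()) , λ _ → refl
childrenName-false true  false _ = (λ _ ()) , λ _ → refl
childrenName-false false true  _ = (λ ()) , λ ≢1 → ⊥-elim (≢1 refl)
childrenName-false false false leaf = ⊥-elim (leaf refl refl)

childrenName-true : ∀ a b → (a ≡ false → b ≡ false → ⊥) →
  (b ≡ true → childrenName a b ≢ zeroT) × (childrenName a b ≢ zeroT → b ≡ true)
childrenName-true true  true  _ = (λ _ ()) , λ _ → refl
childrenName-true true  false _ = (λ ()) , λ ≢0 → ⊥-elim (≢0 refl)
childrenName-true false true  _ = (λ _ ()) , λ _ → refl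
childrenName-true false false leaf = ⊥-elim (leaf refl refl)

pruned-child : ∀ (P : PTree) w → w ∈T tree P →
  set (tree P) (w ++ false ∷ []) ≡ false → set (tree P) (w ++ true ∷ []) ≡ false → ⊥
pruned-child P w w∈P no₀ no₁ with pruned P w w∈P
... | []    , v≢[] , _    = v≢[] refl
... | b ∷ v , _    , wbv∈P = no-child b (closed (tree P) (w ++ b ∷ []) v (subst (_∈T tree P) (sym (++-assoc w (b ∷ []) v)) wbv∈P))
  where
  no-child : ∀ b → (w ++ b ∷ []) ∈T tree P → ⊥
  no-child true  wb∈P = true≢false (trans (sym wb∈P) no₁)
  no-child false wb∈P = true≢false (trans (sym wb∈P) no₀)

δPT-nameOf : ∀ P → δPT (nameOf P) P
δPT-nameOf P = empty , λ x₀≡⊥ → root x₀≡⊥ , λ { .(ν n) n w∈P refl →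
  let leaf = pruned-child P (ν n) w∈P
  in childrenName-false (S (ν n ++ false ∷ [])) (S (ν n ++ true ∷ [])) leaf .proj₁ ,
     childrenName-false (S (ν n ++ false ∷ [])) (S (ν n ++ true ∷ [])) leaf .proj₂ ,
     childrenName-true  (S (ν n ++ false ∷ [])) (S (ν n ++ true ∷ [])) leaf .proj₁ ,
     childrenName-true  (S (ν n ++ false ∷ [])) (S (ν n ++ true ∷ [])) leaf .proj₂ }
  where
  S = set (tree P)
  empty : nameOf P zero ≢ botT → ∀ w → S w ≡ false
  empty x₀≢⊥ w with S w in w∈ | S [] in ε∈
  ... | false | _     = refl
  ... | true  | true  = ⊥-elim (x₀≢⊥ refl)
  ... | true  | false = ⊥-elim (true≢false (trans (sym (closed (tree P) [] w w∈)) ε∈))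
  root : nameOf P zero ≡ botT → S [] ≡ true
  root x₀≡⊥ with S [] | x₀≡⊥
  ... | true | _ = refl

-- From a name of a pruned tree to its characteristic sequence

_==_ : Bool → Bool → Bool
a == b = bit a ≡ᵇ bit b

==-sound : ∀ a b → (a == b) ≡ true → a ≡ b
==-sound true  true  _ = refl
==-sound false false _ = refl

==-refl : ∀ a → (a == a) ≡ true
==-refl true  = refl
==-refl false = refl

-- the code of the parent of the non-root node c has its first 1 at j, with the parity that excludes c
cutAt : Cantor → ℕ → ℕ → Bool
cutAt r c j = firstOneAt r (suc (parent c)) j ∧ (even j == even c)

uncut : Cantor → ℕ → ℕ → Bool
uncut r S c = not (any< S (cutAt r c))

rootUncut : Cantor → ℕ → Bool
rootUncut r S = all< S (λ j → not (component r 0 j))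

-- node i survives stage i: neither the root nor any ancestor of i (i itself included) has been cut by then
alive : Cantor → ℕ → Bool
alive r i = rootUncut r i ∧ all< (suc i) (λ u → (ancestor u i ≡ᵇ 0) ∨ uncut r i (ancestor u i))

-- component n of the 𝕋^ω-name of the tree has its first 1 at position 1 if n is alive, at 0 otherwise
aliveName : Cantor → ℕ → Bool
aliveName r n = ((unpairʳ n ≡ᵇ 0) ∧ not (alive r (unpairˡ n))) ∨ ((unpairʳ n ≡ᵇ 1) ∧ alive r (unpairˡ n))

pr-aliveName : PRᵇ 1 (λ r ρ → aliveName r (ρ zero))
pr-aliveName =
  pr-∨ (pr-∧ (pr-≡ᵇ (pr-unpairʳ v₀) pr-zero) (pr-not (pr-alive (pr-unpairˡ v₀))))
       (pr-∧ (pr-≡ᵇ (pr-unpairʳ v₀) (pr-const 1)) (pr-alive (pr-unpairˡ v₀)))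
  where
  pr-uncut : ∀ {n} {a b : OracleFn n} → PR n a → PR n b → PRᵇ n (λ r ρ → uncut r (a r ρ) (b r ρ))
  pr-uncut = pr-∘₂ {F = λ r x y → bit (uncut r x y)}
    (pr-not (pr-any< v₀ (pr-∧ (pr-firstOneAt (pr-suc (pr-parent v₂)) v₀) (pr-≡ᵇ (pr-even v₀) (pr-even v₂)))))
  pr-alive : ∀ {n} {a : OracleFn n} → PR n a → PRᵇ n (λ r ρ → alive r (a r ρ))
  pr-alive = pr-∘₁ {F = λ r x → bit (alive r x)}
    (pr-∧ (pr-all< v₀ (pr-not (pr-query (pr-pair pr-zero v₀))))
          (pr-all< (pr-suc v₀) (pr-∨ (pr-≡ᵇ (pr-ancestor v₀ v₁) pr-zero) (pr-uncut v₁ (pr-ancestor v₀ v₁)))))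

uncut-mono : ∀ r {S S′} c → S ≤ S′ → uncut r S′ c ≡ true → uncut r S c ≡ true
uncut-mono r {S} {S′} c S≤S′ uncut′ with any< S (cutAt r c) in cut
... | false = refl
... | true  = let j , j<S , fj = any<-elim S _ cut in
  ⊥-elim (true≢false (trans (sym (any<-intro S′ _ j (<-≤-trans j<S S≤S′) fj)) (not-false uncut′)))

alive-parent : ∀ r k b → alive r (child k b) ≡ true → alive r k ≡ true
alive-parent r k b alive-c = ∧-intro root (all<-intro (suc k) _ ancestors)
  where
  c = child k b
  root : rootUncut r k ≡ true
  root = all<-intro k _ (λ j j<k → all<-elim c _ (∧-conicalˡ _ _ alive-c) j (<-trans j<k (child-> k b)))
  one-level-up : ∀ u → ancestor (suc u) c ≡ ancestor u k
  one-level-up u = trans (ancestor-suc u c) (cong (ancestor u) (parent-child k b))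
  ancestors : ∀ u → u < suc k → ((ancestor u k ≡ᵇ 0) ∨ uncut r k (ancestor u k)) ≡ true
  ancestors u u≤k with ∨-elim (all<-elim (suc c) (λ u → (ancestor u c ≡ᵇ 0) ∨ uncut r c (ancestor u c))
                                  (∧-conicalʳ (rootUncut r c) _ alive-c) (suc u) (s≤s (≤-trans u≤k (child-> k b))))
  ... | inj₁ root-reached = ∨-introˡ (subst (λ v → (v ≡ᵇ 0) ≡ true) (one-level-up u) root-reached)
  ... | inj₂ uncut-c      =
    ∨-introʳ (uncut-mono r (ancestor u k) (<⇒≤ (child-> k b)) (subst (λ v → uncut r c v ≡ true) (one-level-up u) uncut-c))

aliveSet : Cantor → WordSet
aliveSet r w = alive r (index w)

aliveSet-closed : ∀ r → PrefixClosed (aliveSet r)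
aliveSet-closed r w []      e = subst (λ v → aliveSet r v ≡ true) (++-identityʳ w) e
aliveSet-closed r w (b ∷ v) e =
  alive-parent r (index w) b (subst (λ i → alive r i ≡ true) (index-snoc w b)
    (aliveSet-closed r (w ++ b ∷ []) v (subst (λ u → aliveSet r u ≡ true) (sym (++-assoc w (b ∷ []) v)) e)))

aliveTree : Cantor → Tree
aliveTree r = mkTree (aliveSet r) (aliveSet-closed r)

aliveName-δTω : ∀ r y → δTω (aliveName r) y → ∀ n → y n ≡ toTri (alive r n)
aliveName-δTω r y dy n with alive r n in eq
... | false = δT-FirstOne (dy n) (first , λ i ())
  where
  first : aliveName r (pair n 0) ≡ true
  first rewrite unpairˡ-pair n 0 | unpairʳ-pair n 0 | eq = refl
... | true = δT-FirstOne (dy n) (first , before)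
  where
  first : aliveName r (pair n 1) ≡ true
  first rewrite unpairˡ-pair n 1 | unpairʳ-pair n 1 | eq = refl
  before : ∀ i → i < 1 → aliveName r (pair n i) ≡ false
  before zero z<s rewrite unpairˡ-pair n 0 | unpairʳ-pair n 0 | eq = refl

module AliveTree (r : Cantor) (x : TSeq) (dx : δTω r x) (P : PTree) (dP : δPT x P) where

  cut⇒excluded : ∀ k b j → cutAt r (child k b) j ≡ true → x (suc k) ≡ exclude b
  cut⇒excluded k b j cut = trans (δT-FirstOne (dx (suc k)) first) (cong exclude same-parity)
    where
    first : FirstOne (component r (suc k)) j
    first = subst (λ v → FirstOne (component r (suc v)) j) (parent-child k b)
              (firstOneAt⇒FirstOne r (suc (parent (child k b))) j (∧-conicalˡ _ _ cut))
    same-parity : even j ≡ b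
    same-parity = trans (==-sound _ _ (∧-conicalʳ _ _ cut)) (even-child k b)

  excluded⇒cut : ∀ k b → x (suc k) ≡ exclude b → ∃ λ j → cutAt r (child k b) j ≡ true
  excluded⇒cut k b excluded =
    let j , first = δT-≢botT (dx (suc k)) (λ x≡⊥ → exclude≢botT b (trans (sym excluded) x≡⊥))
        same-parity : even j ≡ b
        same-parity = exclude-injective (trans (sym (δT-FirstOne (dx (suc k)) first)) excluded)
    in j , ∧-intro (FirstOne⇒firstOneAt r (suc (parent (child k b))) j (subst (λ v → FirstOne (component r (suc v)) j) (sym (parent-child k b)) first))
                   (subst (λ v → (even j == v) ≡ true) (trans same-parity (sym (even-child k b))) (==-refl (even j)))

  uncut-on-path : ∀ p m S → prefix p (suc m) ∈T tree P → x zero ≡ botT → uncut r S (node p (suc m)) ≡ true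
  uncut-on-path p m S child∈P x₀≡⊥ rewrite node-suc p m with any< S (cutAt r (child (node p m) (p m))) in cut
  ... | false = refl
  ... | true  = let j , _ , cut-j = any<-elim S _ cut in
    ⊥-elim (δPT-child⁻ {x} {P} dP (prefix p m) (node p m) (p m) (closed (tree P) (prefix p m) _ child∈P) (ν-node p m) x₀≡⊥
              child∈P (cut⇒excluded (node p m) (p m) j cut-j))

  paths-alive : ∀ p → p ∈[ tree P ] → ∀ N → alive r (node p N) ≡ true
  paths-alive p p∈P N = ∧-intro root (all<-intro (suc (node p N)) _ ancestors)
    where
    x₀≡⊥ : x zero ≡ botT
    x₀≡⊥ = δPT-root {x} {P} dP (p∈P 0)
    root : rootUncut r (node p N) ≡ true
    root = all<-intro (node p N) _ (λ j _ → not-true (δT-botT (subst (δT (component r 0)) x₀≡⊥ (dx 0)) j))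
    ancestors : ∀ u → u < suc (node p N) → ((ancestor u (node p N) ≡ᵇ 0) ∨ uncut r (node p N) (ancestor u (node p N))) ≡ true
    ancestors u _ with N ≤? u
    ... | yes N≤u = ∨-introˡ (≡ᵇ-true (ancestor-node-root p N u N≤u))
    ... | no  N≰u = ∨-introʳ (subst (λ v → uncut r (node p N) v ≡ true) (sym on-path)
                      (uncut-on-path p (N ∸ suc u) (node p N) (p∈P (suc (N ∸ suc u))) x₀≡⊥))
      where
      on-path : ancestor u (node p N) ≡ node p (suc (N ∸ suc u))
      on-path = trans (ancestor-node p N u (<⇒≤ (≰⇒> N≰u))) (cong (node p) (+-∸-assoc 1 (≰⇒> N≰u)))

  alive-paths : ∀ p → (∀ N → alive r (node p N) ≡ true) → p ∈[ tree P ]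
  alive-paths p alive-p = on-path
    where
    x₀≡⊥ : x zero ≡ botT
    x₀≡⊥ with δT-cases (dx 0)
    ... | inj₁ x₀≡⊥          = x₀≡⊥
    ... | inj₂ (j , rj , _) = ⊥-elim (true≢false (trans (sym rj)
            (not-false (all<-elim (node p (suc j)) _ (∧-conicalˡ _ _ (alive-p (suc j))) j (node-≥ p (suc j))))))
    -- an exclusion of the next node of p, made at position j of the parent's code, would cut the node of p at depth 1 + n + j
    not-excluded : ∀ n → x (suc (node p n)) ≢ exclude (p n)
    not-excluded n excluded =
      let j , cut-j = excluded⇒cut (node p n) (p n) excluded
          N = suc n + j
          j<S : j < node p N
          j<S = <-≤-trans (s≤s (m≤n+m j n)) (node-≥ p N)
          child≡ : ancestor j (node p N) ≡ child (node p n) (p n)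
          child≡ = trans (ancestor-node p N j (m≤n+m j (suc n))) (trans (cong (node p) (m+n∸n≡m (suc n) j)) (node-suc p n))
          survives : ((ancestor j (node p N) ≡ᵇ 0) ∨ uncut r (node p N) (ancestor j (node p N))) ≡ true
          survives = all<-elim (suc (node p N)) _ (∧-conicalʳ (rootUncut r (node p N)) _ (alive-p N)) j (m<n⇒m<1+n j<S)
      in [ (λ root-reached → true≢false (trans (sym root-reached) (subst (λ v → (v ≡ᵇ 0) ≡ false) (sym child≡)
                                                                    (child≢0 (node p n) (p n)))))
         , (λ uncut-c → true≢false (trans (sym (any<-intro (node p N) _ j j<S cut-j))
                                           (not-false (subst (λ v → uncut r (node p N) v ≡ true) child≡ uncut-c))))
         ]′ (∨-elim survives)
    on-path : ∀ n → prefix p n ∈T tree P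
    on-path zero    = proj₁ (proj₂ dP x₀≡⊥)
    on-path (suc n) = δPT-child⁺ {x} {P} dP (prefix p n) (node p n) (p n) (on-path n) (ν-node p n) x₀≡⊥ (not-excluded n)

-- From a characteristic sequence to a name of its pruned tree

leftmost : ℕ → ℕ → ℕ
leftmost k s = natrec s k (λ _ a → suc (a + a))

-- the descendants of k at depth s are descendant k s t for t < 2 ^ s
descendant : ℕ → ℕ → ℕ → ℕ
descendant k s t = leftmost k s + t

pr-descendant : ∀ {n} {a b c : OracleFn n} → PR n a → PR n b → PR n c →
  PR n (λ r ρ → descendant (a r ρ) (b r ρ) (c r ρ))
pr-descendant = pr-∘₃ {F = λ r x y z → descendant x y z} (pr-+ (pr-natrec v₁ v₀ (pr-suc (pr-+ v₁ v₁))) v₂)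

leftmost-child-false : ∀ k s → leftmost k (suc s) ≡ leftmost (child k false) s
leftmost-child-false k zero    = refl
leftmost-child-false k (suc s) = cong (λ a → suc (a + a)) (leftmost-child-false k s)

leftmost-child-true : ∀ k s → leftmost (child k true) s ≡ leftmost (child k false) s + 2 ^ s
leftmost-child-true k zero    = sym (+-comm (suc (k + k)) 1)
leftmost-child-true k (suc s) rewrite leftmost-child-true k s = shift (leftmost (child k false) s) (2 ^ s)
  where
  shift : ∀ a x → suc ((a + x) + (a + x)) ≡ suc (a + a) + (x + (x + 0))
  shift = solve-∀

half-double-+ : ∀ a t → ⌊ (a + a + t) /2⌋ ≡ a + ⌊ t /2⌋
half-double-+ zero    t = refl
half-double-+ (suc a) t rewrite +-suc a a = cong suc (half-double-+ a t)

half-<-double : ∀ t n → t < n + n → ⌊ t /2⌋ < n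
half-<-double zero          (suc n) _ = z<s
half-<-double (suc zero)    (suc n) _ = z<s
half-<-double (suc (suc t)) (suc n) (s≤s t<n+1+n) rewrite +-suc n n = s≤s (half-<-double t n (≤-pred t<n+1+n))

double-+-bit-< : ∀ {t n} b → t < n → t + t + bit b < n + n
double-+-bit-< {t} {n} b t<n = ≤-trans (s≤s (+-monoʳ-≤ (t + t) (bit≤1 b))) (≤-trans (≤-reflexive (sym (+-suc-suc t)))
                                 (+-mono-≤ t<n t<n))
  where
  bit≤1 : ∀ b → bit b ≤ 1
  bit≤1 true  = s≤s z≤n
  bit≤1 false = z≤n
  +-suc-suc : ∀ t → suc t + suc t ≡ suc (t + t + 1)
  +-suc-suc = solve-∀

descendant-parent : ∀ k s t → parent (descendant k (suc s) t) ≡ descendant k s ⌊ t /2⌋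
descendant-parent k s t = half-double-+ (leftmost k s) t

descendant-child : ∀ k s t b → descendant k (suc s) (t + t + bit b) ≡ child (descendant k s t) b
descendant-child k s t true  = right (leftmost k s) t
  where
  right : ∀ a t → suc (a + a) + (t + t + 1) ≡ suc (suc ((a + t) + (a + t)))
  right = solve-∀
descendant-child k s t false = left (leftmost k s) t
  where
  left : ∀ a t → suc (a + a) + (t + t + 0) ≡ suc ((a + t) + (a + t))
  left = solve-∀

descendant-self : ∀ k → descendant k 0 0 ≡ k
descendant-self k = +-identityʳ k

descendant-split-false : ∀ k s t → descendant k (suc s) t ≡ descendant (child k false) s t
descendant-split-false k s t = cong (_+ t) (leftmost-child-false k s)

descendant-split-true : ∀ k s t → 2 ^ s ≤ t → descendant k (suc s) t ≡ descendant (child k true) s (t ∸ 2 ^ s)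
descendant-split-true k s t 2^s≤t = begin
  leftmost k (suc s) + t                                   ≡⟨ cong (_+ t) (leftmost-child-false k s) ⟩
  leftmost (child k false) s + t                           ≡⟨ cong (leftmost (child k false) s +_) (sym (m+[n∸m]≡n 2^s≤t)) ⟩
  leftmost (child k false) s + (2 ^ s + (t ∸ 2 ^ s))       ≡⟨ sym (+-assoc (leftmost (child k false) s) (2 ^ s) _) ⟩
  leftmost (child k false) s + 2 ^ s + (t ∸ 2 ^ s)         ≡⟨ cong (_+ (t ∸ 2 ^ s)) (sym (leftmost-child-true k s)) ⟩
  leftmost (child k true) s + (t ∸ 2 ^ s)                  ∎
  where open ≡-Reasoning

descendant-node : ∀ p n s → ∃ λ t → t < 2 ^ s × descendant (node p n) s t ≡ node p (n + s)
descendant-node p n zero = 0 , z<s , trans (descendant-self (node p n)) (cong (node p) (sym (+-identityʳ n)))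
descendant-node p n (suc s) =
  let t , t<2^s , at-depth = descendant-node p n s
      b = p (n + s)
  in t + t + bit b ,
     subst (t + t + bit b <_) (cong (2 ^ s +_) (sym (+-identityʳ (2 ^ s)))) (double-+-bit-< b t<2^s) ,
     trans (descendant-child (node p n) s t b)
       (trans (cong (λ v → child v b) at-depth) (trans (sym (node-suc p (n + s))) (cong (node p) (sym (+-suc n s)))))

-- by stage B the name of the tree shows that node k is not in it
seenOut : Cantor → ℕ → ℕ → Bool
seenOut r k B = any< B (λ j → firstOneAt r k j ∧ even j)

-- by stage B every descendant of k at depth s has been seen out, itself or at an ancestor below k
dead : Cantor → ℕ → ℕ → ℕ → Bool
dead r k s B = all< (2 ^ s) (λ t → any< (suc s) (λ u → seenOut r (ancestor u (descendant k s t)) B))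

-- component 0 gets a 1 at ⟨s , B⟩ when the root is dead by (s , B), which empties the tree; component
-- k + 1 gets a 1 at j when the child of k of parity even j is dead by ⌊ j /2⌋, so that a first 1 excludes a
-- dead child
pruneName : Cantor → ℕ → Bool
pruneName r n =
  if unpairˡ n ≡ᵇ 0 then dead r 0 (unpairˡ (unpairʳ n)) (unpairʳ (unpairʳ n))
  else dead r (child (unpairˡ n ∸ 1) (even (unpairʳ n))) (unpairˡ ⌊ unpairʳ n /2⌋) (unpairʳ ⌊ unpairʳ n /2⌋)

pr-pruneName : PRᵇ 1 (λ r ρ → pruneName r (ρ zero))
pr-pruneName = pr-cast (λ r ρ → if-bit (unpairˡ (ρ zero) ≡ᵇ 0) _ _)
  (pr-if (pr-≡ᵇ (pr-unpairˡ v₀) pr-zero)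
    (pr-dead pr-zero (pr-unpairˡ (pr-unpairʳ v₀)) (pr-unpairʳ (pr-unpairʳ v₀)))
    (pr-dead (pr-child (pr-pred (pr-unpairˡ v₀)) (pr-even (pr-unpairʳ v₀)))
             (pr-unpairˡ (pr-half (pr-unpairʳ v₀))) (pr-unpairʳ (pr-half (pr-unpairʳ v₀)))))
  where
  if-bit : ∀ c x y → (if c then bit x else bit y) ≡ bit (if c then x else y)
  if-bit true  x y = refl
  if-bit false x y = refl
  pr-seenOut : ∀ {n} {a b : OracleFn n} → PR n a → PR n b → PRᵇ n (λ r ρ → seenOut r (a r ρ) (b r ρ))
  pr-seenOut = pr-∘₂ {F = λ r x y → bit (seenOut r x y)} (pr-any< v₁ (pr-∧ (pr-firstOneAt v₁ v₀) (pr-even v₀)))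
  pr-dead : ∀ {n} {a b c : OracleFn n} → PR n a → PR n b → PR n c → PRᵇ n (λ r ρ → dead r (a r ρ) (b r ρ) (c r ρ))
  pr-dead = pr-∘₃ {F = λ r x y z → bit (dead r x y z)}
    (pr-all< (pr-2^ v₁)
      (pr-any< (pr-suc v₂)
        (pr-seenOut (pr-ancestor v₀ (pr-descendant v₂ (pr-var (suc (suc (suc zero)))) v₁))
                    (pr-var (suc (suc (suc (suc zero))))))))

module _ (r : Cantor) where

  seenOut-mono : ∀ k {B B′} → B ≤ B′ → seenOut r k B ≡ true → seenOut r k B′ ≡ true
  seenOut-mono k {B} {B′} B≤B′ seen =
    let j , j<B , fj = any<-elim B _ seen in any<-intro B′ _ j (<-≤-trans j<B B≤B′) fj

  dead-mono-stage : ∀ k s {B B′} → B ≤ B′ → dead r k s B ≡ true → dead r k s B′ ≡ true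
  dead-mono-stage k s B≤B′ d = all<-intro (2 ^ s) _ λ t t<2^s →
    let u , u≤s , seen = any<-elim (suc s) _ (all<-elim (2 ^ s) _ d t t<2^s)
    in any<-intro (suc s) _ u u≤s (seenOut-mono (ancestor u (descendant k s t)) B≤B′ seen)

  dead-suc-depth : ∀ k s B → dead r k s B ≡ true → dead r k (suc s) B ≡ true
  dead-suc-depth k s B d = all<-intro (2 ^ suc s) _ λ t t<2^1+s →
    let u , u≤s , seen = any<-elim (suc s) _
                           (all<-elim (2 ^ s) _ d ⌊ t /2⌋ (half-<-double t (2 ^ s) (subst (t <_) (cong (2 ^ s +_) (+-identityʳ _)) t<2^1+s)))
    in any<-intro (suc (suc s)) _ (suc u) (s≤s u≤s)
         (subst (λ v → seenOut r v B ≡ true)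
           (sym (trans (ancestor-suc u (descendant k (suc s) t)) (cong (ancestor u) (descendant-parent k s t)))) seen)

  dead-mono-depth : ∀ k s S B → s ≤ S → dead r k s B ≡ true → dead r k S B ≡ true
  dead-mono-depth k s zero    B z≤n d = d
  dead-mono-depth k s (suc S) B s≤1+S d with m≤n⇒m<n∨m≡n s≤1+S
  ... | inj₂ refl  = d
  ... | inj₁ s<1+S = dead-suc-depth k S B (dead-mono-depth k s S B (≤-pred s<1+S) d)

  dead-mono : ∀ k {s S B B′} → s ≤ S → B ≤ B′ → dead r k s B ≡ true → dead r k S B′ ≡ true
  dead-mono k {s} {S} {B} {B′} s≤S B≤B′ d = dead-mono-depth k s S B′ s≤S (dead-mono-stage k s B≤B′ d)

  seenOut⇒dead : ∀ k B → seenOut r k B ≡ true → dead r k 0 B ≡ true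
  seenOut⇒dead k B seen = ∧-intro refl (∨-introʳ {false} (subst (λ v → seenOut r v B ≡ true) (sym (descendant-self k)) seen))

  -- the descendants of k at depth 1 + S are those of its two children at depth S
  dead-children : ∀ k S B → dead r (child k false) S B ≡ true → dead r (child k true) S B ≡ true →
    dead r k (suc S) B ≡ true
  dead-children k S B d₀ d₁ = all<-intro (2 ^ suc S) _ covered
    where
    covered : ∀ t → t < 2 ^ suc S → any< (suc (suc S)) (λ u → seenOut r (ancestor u (descendant k (suc S) t)) B) ≡ true
    covered t t<2^1+S with 2 ^ S ≤? t
    ... | no 2^S≰t =
      let u , u≤S , seen = any<-elim (suc S) _ (all<-elim (2 ^ S) _ d₀ t (≰⇒> 2^S≰t))
      in any<-intro (suc (suc S)) _ u (m<n⇒m<1+n u≤S)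
           (subst (λ v → seenOut r (ancestor u v) B ≡ true) (sym (descendant-split-false k S t)) seen)
    ... | yes 2^S≤t =
      let t′<2^S : t ∸ 2 ^ S < 2 ^ S
          t′<2^S = subst (t ∸ 2 ^ S <_) (m+n∸m≡n (2 ^ S) (2 ^ S))
                     (∸-monoˡ-< (subst (t <_) (cong (2 ^ S +_) (+-identityʳ (2 ^ S))) t<2^1+S) 2^S≤t)
          u , u≤S , seen = any<-elim (suc S) _ (all<-elim (2 ^ S) _ d₁ (t ∸ 2 ^ S) t′<2^S)
      in any<-intro (suc (suc S)) _ u (m<n⇒m<1+n u≤S)
           (subst (λ v → seenOut r (ancestor u v) B ≡ true) (sym (descendant-split-true k S t 2^S≤t)) seen)

  dead-siblings : ∀ k b s B s′ B′ → dead r (child k b) s B ≡ true → dead r (child k (not b)) s′ B′ ≡ true →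
    ∃₂ λ S B″ → dead r k S B″ ≡ true
  dead-siblings k true  s B s′ B′ d₁ d₀ =
    suc (s′ ⊔ s) , B′ ⊔ B , dead-children k (s′ ⊔ s) (B′ ⊔ B) (dead-mono (child k false) (m≤m⊔n s′ s) (m≤m⊔n B′ B) d₀)
                                                            (dead-mono (child k true) (m≤n⊔m s′ s) (m≤n⊔m B′ B) d₁)
  dead-siblings k false s B s′ B′ d₀ d₁ =
    suc (s ⊔ s′) , B ⊔ B′ , dead-children k (s ⊔ s′) (B ⊔ B′) (dead-mono (child k false) (m≤m⊔n s s′) (m≤m⊔n B B′) d₀)
                                                            (dead-mono (child k true) (m≤n⊔m s s′) (m≤n⊔m B B′) d₁)

withParity : Bool → ℕ → ℕ
withParity true  h = h + h
withParity false h = suc (h + h)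

even-withParity : ∀ b h → even (withParity b h) ≡ b
even-withParity true  h = even-double h
even-withParity false h = trans (even-suc (h + h)) (cong not (even-double h))

half-withParity : ∀ b h → ⌊ withParity b h /2⌋ ≡ h
half-withParity true  h = half-double h
half-withParity false h = half-suc-double h

pruneName-root : ∀ r j → pruneName r (pair 0 j) ≡ dead r 0 (unpairˡ j) (unpairʳ j)
pruneName-root r j rewrite unpairˡ-pair 0 j | unpairʳ-pair 0 j = refl

pruneName-child : ∀ r k j → pruneName r (pair (suc k) j) ≡ dead r (child k (even j)) (unpairˡ ⌊ j /2⌋) (unpairʳ ⌊ j /2⌋)
pruneName-child r k j rewrite unpairˡ-pair (suc k) j | unpairʳ-pair (suc k) j = refl

pruneName-dead : ∀ r k b s B → dead r (child k b) s B ≡ true → pruneName r (pair (suc k) (withParity b (pair s B))) ≡ true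
pruneName-dead r k b s B d rewrite pruneName-child r k (withParity b (pair s B)) | even-withParity b (pair s B)
  | half-withParity b (pair s B) | unpairˡ-pair s B | unpairʳ-pair s B = d

module PruneName (r : Cantor) (x : TSeq) (dx : δTω r x) (T : Tree) (xT : ψ 𝒯 x T) where

  seenOut-sound : ∀ k B → seenOut r k B ≡ true → set T (ν k) ≡ false
  seenOut-sound k B seen =
    let j , _ , fj = any<-elim B _ seen
    in toTri-injective (trans (sym (xT k)) (trans (δT-FirstOne (dx k) (firstOneAt⇒FirstOne r k j (∧-conicalˡ _ _ fj)))
                                                 (cong exclude (∧-conicalʳ (firstOneAt r k j) _ fj))))

  seenOut-complete : ∀ k → set T (ν k) ≡ false → ∃ λ B → seenOut r k B ≡ true
  seenOut-complete k k∉T =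
    let xk≡0 : x k ≡ zeroT
        xk≡0 = trans (xT k) (cong toTri k∉T)
        j , first = δT-≢botT (dx k) (λ xk≡⊥ → exclude≢botT true (trans (sym xk≡0) xk≡⊥))
        even-j : even j ≡ true
        even-j = sym (exclude-injective {true} (trans (sym xk≡0) (δT-FirstOne (dx k) first)))
    in suc j , any<-intro (suc j) _ j ≤-refl (∧-intro (FirstOne⇒firstOneAt r k j first) even-j)

  dead-sound : ∀ p n s B → dead r (node p n) s B ≡ true → ∃ λ m → set T (prefix p m) ≡ false
  dead-sound p n s B d =
    let t , t<2^s , at-depth = descendant-node p n s
        u , u≤s , seen = any<-elim (suc s) _ (all<-elim (2 ^ s) _ d t t<2^s)
        m = n + s ∸ u
        seen′ : seenOut r (node p m) B ≡ true
        seen′ = subst (λ v → seenOut r v B ≡ true)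
                  (trans (cong (ancestor u) at-depth) (ancestor-node p (n + s) u (≤-trans (≤-pred u≤s) (m≤n+m s n)))) seen
    in m , subst (λ w → set T w ≡ false) (ν-node p m) (seenOut-sound (node p m) B seen′)

  module _ (y : TSeq) (dy : δTω (pruneName r) y) (Z : PTree) (dZ : δPT y Z) where

    paths-pruned : ∀ p → p ∈[ T ] → p ∈[ tree Z ]
    paths-pruned p p∈T = on-path
      where
      y₀≡⊥ : y zero ≡ botT
      y₀≡⊥ with δT-cases (dy 0)
      ... | inj₁ y₀≡⊥         = y₀≡⊥
      ... | inj₂ (j , dead-j , _) =
        let m , p∉T = dead-sound p 0 (unpairˡ j) (unpairʳ j) (trans (sym (pruneName-root r j)) dead-j)
        in ⊥-elim (true≢false (trans (sym (p∈T m)) p∉T))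
      not-excluded : ∀ n → y (suc (node p n)) ≢ exclude (p n)
      not-excluded n excluded =
        let j , first = δT-≢botT (dy (suc (node p n))) (λ y≡⊥ → exclude≢botT (p n) (trans (sym excluded) y≡⊥))
            parity : even j ≡ p n
            parity = exclude-injective (trans (sym (δT-FirstOne (dy (suc (node p n))) first)) excluded)
            child-dead : dead r (node p (suc n)) (unpairˡ ⌊ j /2⌋) (unpairʳ ⌊ j /2⌋) ≡ true
            child-dead = subst (λ v → dead r v (unpairˡ ⌊ j /2⌋) (unpairʳ ⌊ j /2⌋) ≡ true)
                           (trans (cong (child (node p n)) parity) (sym (node-suc p n)))
                           (trans (sym (pruneName-child r (node p n) j)) (proj₁ first))
            m , p∉T = dead-sound p (suc n) (unpairˡ ⌊ j /2⌋) (unpairʳ ⌊ j /2⌋) child-dead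
        in true≢false (trans (sym (p∈T m)) p∉T)
      on-path : ∀ n → prefix p n ∈T tree Z
      on-path zero    = proj₁ (proj₂ dZ y₀≡⊥)
      on-path (suc n) = δPT-child⁺ {y} {Z} dZ (prefix p n) (node p n) (p n) (on-path n) (ν-node p n) y₀≡⊥ (not-excluded n)

    pruned-paths : ∀ p → p ∈[ tree Z ] → p ∈[ T ]
    pruned-paths p p∈Z m with set T (prefix p m) in eq
    ... | true  = refl
    ... | false = let B , seen = seenOut-complete (node p m) (trans (cong (set T) (ν-node p m)) eq)
                  in ⊥-elim (never-dead m 0 B (seenOut⇒dead r (node p m) B seen))
      where
      y₀≡⊥ : y zero ≡ botT
      y₀≡⊥ = δPT-root {y} {Z} dZ (p∈Z 0)
      never-dead : ∀ n s B → dead r (node p n) s B ≡ true → ⊥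
      never-dead zero    s B d = δT-one⇒≢botT {j = pair s B} (dy 0)
        (trans (pruneName-root r (pair s B)) (subst₂ (λ a c → dead r 0 a c ≡ true) (sym (unpairˡ-pair s B)) (sym (unpairʳ-pair s B)) d))
        y₀≡⊥
      never-dead (suc n) s B d = decide (even j ≟ᵇ b)
        where
        k = node p n
        b = p n
        child-dead : dead r (child k b) s B ≡ true
        child-dead = subst (λ v → dead r v s B ≡ true) (node-suc p n) d
        j-first = δT-≢botT (dy (suc k)) (δT-one⇒≢botT (dy (suc k)) (pruneName-dead r k b s B child-dead))
        j = proj₁ j-first
        decide : Dec (even j ≡ b) → ⊥
        decide (yes same) = δPT-child⁻ {y} {Z} dZ (prefix p n) k b (p∈Z n) (ν-node p n) y₀≡⊥ (p∈Z (suc n))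
                              (trans (δT-FirstOne (dy (suc k)) (proj₂ j-first)) (cong exclude same))
        decide (no diff) =
          let sibling-dead = subst (λ c → dead r (child k c) (unpairˡ ⌊ j /2⌋) (unpairʳ ⌊ j /2⌋) ≡ true) (¬-not diff)
                               (trans (sym (pruneName-child r k j)) (proj₁ (proj₂ j-first)))
              S , B′ , parent-dead = dead-siblings r k b s B (unpairˡ ⌊ j /2⌋) (unpairʳ ⌊ j /2⌋) child-dead sibling-dead
          in never-dead n S B′ parent-dead

-- Realizers

𝒯-name-unique : ∀ (x : TSeq) T T′ → ψ 𝒯 x T → ψ 𝒯 x T′ → ∀ w → set T w ≡ set T′ w
𝒯-name-unique x T T′ xT xT′ w =
  subst (λ u → set T u ≡ set T′ u) (ν-index w) (toTri-injective (trans (sym (xT (index w))) (xT′ (index w))))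

paths-cong : ∀ T T′ → (∀ w → set T w ≡ set T′ w) → ∀ p → p ∈[ T ] → p ∈[ T′ ]
paths-cong T T′ same p p∈T n = trans (sym (same (prefix p n))) (p∈T n)

-- a realizer may be taken to be the relation of all correct answers; computability asks for a program finding one
PruneRealizer : MV TSeq TSeq
PruneRealizer x y = ∀ T → ψ 𝒯 x T → (∃ λ Z → δPT y Z) × (∀ Z → δPT y Z → IsPrune T Z)

pruneRealizer-computable : ComputableMV PruneRealizer
pruneRealizer-computable =
  program (term pr-pruneName) ,
  λ r x dx _ → pruneName r ,
    program-computes (term pr-pruneName) pruneName (λ r n → eval-term pr-pruneName r (λ _ → n)) r ,
    λ y dy T xT → (namedTree y , δPT-namedTree y) ,
      λ Z dZ p → PruneName.pruned-paths r x dx T xT y dy Z dZ p , PruneName.paths-pruned r x dx T xT y dy Z dZ p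

pruneRealizer-realizes : Realizes 𝒯 PT PruneRealizer Prune
pruneRealizer-realizes x T xT (P , T↦P) = (nameOf P , realizes , namedTree (nameOf P) , δPT-namedTree (nameOf P)) ,
                                          λ y realizes-y → realizes-y T xT
  where
  realizes : PruneRealizer x (nameOf P)
  realizes T′ xT′ = (namedTree (nameOf P) , δPT-namedTree (nameOf P)) , λ Z dZ p →
    (λ p∈Z → paths-cong T T′ (𝒯-name-unique x T T′ xT xT′) p (proj₁ (T↦P p) (δPT-paths {nameOf P} {Z} {P} dZ (δPT-nameOf P) p p∈Z))) ,
    (λ p∈T′ → δPT-paths {nameOf P} {P} {Z} (δPT-nameOf P) dZ p (proj₂ (T↦P p) (paths-cong T′ T (𝒯-name-unique x T′ T xT′ xT) p p∈T′)))

PruneInvRealizer : MV TSeq TSeq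
PruneInvRealizer x y = ∀ P → δPT x P → (∃ λ T → ψ 𝒯 y T) × (∀ T → ψ 𝒯 y T → IsPrune T P)

pruneInvRealizer-computable : ComputableMV PruneInvRealizer
pruneInvRealizer-computable =
  program (term pr-aliveName) ,
  λ r x dx _ → aliveName r ,
    program-computes (term pr-aliveName) aliveName (λ r n → eval-term pr-aliveName r (λ _ → n)) r ,
    λ y dy P dP →
      (aliveTree r , λ n → trans (aliveName-δTω r y dy n) (cong (toTri ∘ alive r) (sym (index-ν n)))) ,
      λ T yT p →
        let T≡alive : ∀ w → set T w ≡ alive r (index w)
            T≡alive w = subst (λ u → set T u ≡ alive r (index w)) (ν-index w)
                          (toTri-injective (trans (sym (yT (index w))) (aliveName-δTω r y dy (index w))))
        in (λ p∈P N → trans (T≡alive (prefix p N)) (AliveTree.paths-alive r x dx P dP p p∈P N)) ,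
           (λ p∈T → AliveTree.alive-paths r x dx P dP p (λ N → trans (sym (T≡alive (prefix p N))) (p∈T N)))

pruneInvRealizer-realizes : Realizes PT 𝒯 PruneInvRealizer PruneInv
pruneInvRealizer-realizes x P dP _ = (characteristic , realizes , tree P , λ n → refl) , λ y realizes-y → realizes-y P dP
  where
  characteristic : TSeq
  characteristic n = toTri (set (tree P) (ν n))
  realizes : PruneInvRealizer x characteristic
  realizes P′ dP′ = (tree P , λ n → refl) , λ T yT p →
    let same = 𝒯-name-unique characteristic (tree P) T (λ n → refl) yT
    in (λ p∈P′ → paths-cong (tree P) T same p (δPT-paths {x} {P′} {P} dP′ dP p p∈P′)) ,
       (λ p∈T → δPT-paths {x} {P} {P′} dP dP′ p (paths-cong T (tree P) (λ w → sym (same w)) p p∈T))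

theorem4 : ComputableMap 𝒯 PT Prune × ComputableMap PT 𝒯 PruneInv
theorem4 = (PruneRealizer , pruneRealizer-computable , pruneRealizer-realizes) ,
           (PruneInvRealizer , pruneInvRealizer-computable , pruneInvRealizer-realizes)
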